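{- Let $G=([d],E)$ be a simple graph, and for each edge $e=\{i,j\}\in E$ let $v_e\in\mathbb{R}^d$ have $i$-th and $j$-th coordinates equal to $1$ and all other coordinates $0$; let $V=(v_e)_{e\in E}$. Let $S\subseteq E$ with $|S|=d$ be such that the $d\times d$ matrix $V_S$ is invertible. Then each connected component of $H=([d],S)$ is the edge-disjoint union of a spanning tree of that component and one additional edge. Moreover, if $t$ of the connected components of $H$ are triangles, then: if $t=\frac d3$, $\operatorname{tr}((V_SV_S^\top)^{ -1})=\frac{3d}4$; and for any $t$, $\operatorname{tr}((V_SV_S^\top)^{ -1})\ge d-\frac{3t}4$.
   Context: $V_S$ is the submatrix of $V$ whose columns are $v_e$, $e\in S$.
   Formalization: The vectors $v_e$, the matrix $V_S$ and its invertibility, and $(V_SV_S^\top)^{ -1}$ with its trace are taken over ℚ instead of ℝ. -}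

module Defs where

open import Data.Nat as ℕ using (ℕ; zero; suc)
open import Data.Fin as Fin using (Fin)
open import Data.Product using (Σ; ∃; _×_; _,_; proj₁; proj₂)
open import Data.Sum using (_⊎_)
open import Data.Rational using (ℚ; 0ℚ; 1ℚ; _+_; _*_)
open import Relation.Binary.PropositionalEquality using (_≡_; _≢_)
open import Relation.Binary.Construct.Closure.ReflexiveTransitive using (Star)
open import Relation.Nullary using (¬_)
open import Data.List using (List; []; _∷_)
open import Data.List.Relation.Unary.AllPairs using (AllPairs)
open import Data.List.Relation.Unary.Linked using (Linked)
open import Data.List.NonEmpty using (List⁺; _∷_)
open import Data.List using (last)
open import Data.Maybe using (just)
open import Function.Bundles using (_⇔_)

-- Vertices are [d] = Fin d.  An (undirected, simple) edge {i,j} is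
-- stored as an ordered pair i < j.

Edge : ℕ → Set
Edge d = Σ (Fin d) λ i → Σ (Fin d) λ j → i Fin.< j

ends : ∀ {d} → Edge d → Fin d × Fin d
ends (i , j , _) = i , j

_∈ₑ_ : ∀ {d} → Fin d → Edge d → Set
u ∈ₑ (i , j , _) = u ≡ i ⊎ u ≡ j

-- Rational matrices (entries 0/1 are rational, so inverses and traces
-- are rational)

Mat : ℕ → ℕ → Set
Mat m n = Fin m → Fin n → ℚ

sumℚ : ∀ {n} → (Fin n → ℚ) → ℚ
sumℚ {zero}  f = 0ℚ
sumℚ {suc n} f = f Fin.zero + sumℚ (λ i → f (Fin.suc i))

_⊗_ : ∀ {m n p} → Mat m n → Mat n p → Mat m p
(A ⊗ B) i k = sumℚ (λ j → A i j * B j k)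

transpose : ∀ {m n} → Mat m n → Mat n m
transpose A i j = A j i

identity : ∀ {n} → Mat n n
identity i j with i Fin.≟ j
... | Relation.Nullary.yes _ = 1ℚ
... | Relation.Nullary.no  _ = 0ℚ

trace : ∀ {n} → Mat n n → ℚ
trace A = sumℚ (λ i → A i i)

IsInverse : ∀ {n} → Mat n n → Mat n n → Set
IsInverse A W = (∀ i j → (A ⊗ W) i j ≡ identity i j) × (∀ i j → (W ⊗ A) i j ≡ identity i j)

Invertible : ∀ {n} → Mat n n → Set
Invertible A = ∃ λ W → IsInverse A W

-- The matrix V_S : column k is v_{S k}, i.e. entry (i , k) is 1 iff
-- i is an endpoint of the edge S k.

VS : ∀ {d m} → (Fin m → Edge d) → Mat d m
VS S i k with i Fin.≟ proj₁ (S k) | i Fin.≟ proj₁ (proj₂ (S k))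
... | Relation.Nullary.yes _ | _ = 1ℚ
... | Relation.Nullary.no _  | Relation.Nullary.yes _ = 1ℚ
... | Relation.Nullary.no _  | Relation.Nullary.no _  = 0ℚ

EdgeSet : ℕ → Set₁
EdgeSet m = Fin m → Set

VertexSet : ℕ → Set₁
VertexSet d = Fin d → Set

Adj : ∀ {d m} → (Fin m → Edge d) → EdgeSet m → Fin d → Fin d → Set
Adj S T u v = ∃ λ k → T k × ((ends (S k) ≡ (u , v)) ⊎ (ends (S k) ≡ (v , u)))

Reach : ∀ {d m} → (Fin m → Edge d) → EdgeSet m → Fin d → Fin d → Set
Reach S T = Star (Adj S T)

allEdges : ∀ {m} → EdgeSet m
allEdges _ = Data.Unit.⊤
  where import Data.Unit

record Cycle {d m} (S : Fin m → Edge d) (T : EdgeSet m) : Set where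
  field
    v₀ v₁ v₂ : Fin d
    rest     : List (Fin d)
    distinct : AllPairs _≢_ (v₀ ∷ v₁ ∷ v₂ ∷ rest)
    path     : Linked (Adj S T) (v₀ ∷ v₁ ∷ v₂ ∷ rest)
    closing  : Adj S T (Data.List.NonEmpty.last (v₂ ∷ rest)) v₀

Acyclic : ∀ {d m} → (Fin m → Edge d) → EdgeSet m → Set
Acyclic S T = ¬ Cycle S T

SpanningTree : ∀ {d m} → (Fin m → Edge d) → VertexSet d → EdgeSet m → Set
SpanningTree S C T =
  (∀ k → T k → ∀ u → u ∈ₑ S k → C u)
  × (∀ u v → C u → C v → Reach S T u v)
  × Acyclic S T

Component : ∀ {d m} → (Fin m → Edge d) → Fin d → VertexSet d
Component S r u = Reach S allEdges r u

CompEdges : ∀ {d m} → (Fin m → Edge d) → Fin d → EdgeSet m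
CompEdges S r k = Component S r (proj₁ (S k))

TreePlusEdge : ∀ {d m} → (Fin m → Edge d) → Fin d → Set₁
TreePlusEdge {m = m} S r =
  ∃ λ (T : EdgeSet m) → ∃ λ (e : Fin m) →
    SpanningTree S (Component S r) T
    × ¬ T e
    × (∀ k → CompEdges S r k → T k ⊎ k ≡ e)
    × (∀ k → T k ⊎ k ≡ e → CompEdges S r k)

IsTriangleComp : ∀ {d m} → (Fin m → Edge d) → Fin d → Set
IsTriangleComp S r =
  ∃ λ a → ∃ λ b → ∃ λ c →
    a ≢ b × b ≢ c × a ≢ c
    × (∀ u → Component S r u ⇔ (u ≡ a ⊎ u ≡ b ⊎ u ≡ c))
    × Adj S allEdges a b × Adj S allEdges b c × Adj S allEdges a c

-- r is the canonical representative (least vertex) of its component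
IsRoot : ∀ {d m} → (Fin m → Edge d) → Fin d → Set
IsRoot S r = ∀ u → Component S r u → r Fin.≤ u

-- exactly t components of H are triangles: f enumerates, without
-- repetition, the representatives of the triangle components.
NumTriangleComps : ∀ {d m} → (Fin m → Edge d) → ℕ → Set
NumTriangleComps {d} S t =
  ∃ λ (f : Fin t → Fin d) →
    (∀ i j → f i ≡ f j → i ≡ j)
    × (∀ r → (IsRoot S r × IsTriangleComp S r) ⇔ (∃ λ i → f i ≡ r))

-- Let W = V_S⁻¹ and let w_k be its k-th row, so that w_k(x) + w_k(u) = δ_kl for every
-- edge l = {x, u} of H.  Weighting the diagonals of V_S W = I and W V_S = I by the
-- indicator of a component C of H counts the vertices of C and the edges of H in C
-- alike, so C has exactly |C| edges.  A graph on d vertices with c components and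
-- e edges has c + e ≥ d, with equality for forests; hence some edge of C lies on a
-- cycle, and removing it leaves a connected graph on C with |C| - 1 edges, which the
-- same inequality forces to be acyclic.
-- The trace of (V_S V_Sᵀ)⁻¹ = Wᵀ W is Σ_k ‖w_k‖².  Propagating the edge relations
-- from the two ends of k gives ‖w_k‖² ≥ 1 unless k lies in a triangle component, in
-- which case w_k = ±½ on the triangle and ‖w_k‖² ≥ 3/4.  At most 3t edges lie in
-- triangles, and if all components are triangles, w_k vanishes off the triangle of k.

module Submission where

open import Defs

open import Algebra.Bundles using (CommutativeMonoid; CommutativeRing)
open import Data.Empty using (⊥; ⊥-elim)
open import Data.Fin.Base as Fin using (Fin; zero; suc)
import Data.Fin.Properties as Fin
open import Data.Integer.Base using (+_)
import Data.Integer.Base as ℤ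
import Data.Integer.Properties as ℤ
open import Data.List.Base as List using (List; []; _∷_; map; foldr)
import Data.List.Properties as List
open import Data.List.Relation.Unary.All as All using (All; []; _∷_)
open import Data.List.Relation.Unary.AllPairs as AllPairs using ([]; _∷_)
open import Data.List.Relation.Unary.Unique.Propositional using (Unique)
open import Data.List.Relation.Unary.Linked as Linked using (Linked; [-]; _∷_)
open import Data.List.NonEmpty as List⁺ using (_∷_)
open import Data.Nat.Base as ℕ using (ℕ; zero; suc; z≤n; s≤s)
import Data.Nat.Properties as ℕ
open import Data.Product using (∃; _×_; _,_; proj₁; proj₂; uncurry)
open import Data.Rational.Base as ℚ using (ℚ; 0ℚ; 1ℚ; ½; -½; _+_; _*_; -_; _-_; _≤_; _/_; toℚᵘ)
import Data.Rational.Properties as ℚ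
open import Data.Rational.Solver using (module +-*-Solver)
open import Data.Rational.Unnormalised.Base as ℚᵘ using (mkℚᵘ; *≡*)
import Data.Rational.Unnormalised.Properties as ℚᵘ
open import Data.Sum using (_⊎_; inj₁; inj₂; [_,_]′)
open import Data.Unit using (tt)
open import Data.Vec.Functional using (updateAt)
import Data.Vec.Functional.Properties as Vector
open import Function.Base using (_∘_; const)
open import Function.Bundles using (_⇔_; mk⇔; Equivalence)
open import Function.Definitions using (Injective)
open import Level using (0ℓ)
open import Relation.Binary.Bundles using (Setoid)
open import Relation.Binary.Definitions using (tri<; tri≈; tri>)
open import Relation.Binary.PropositionalEquality
open import Relation.Nullary using (Dec; yes; no; ¬_)
open import Relation.Nullary.Decidable using (_×-dec_; _⊎-dec_; _→-dec_; ¬?; map′; toWitness)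
open import Relation.Unary using (Decidable; _⊆_)
import Relation.Binary.Construct.Closure.ReflexiveTransitive as Star
open Star using (ε; _◅_; _◅◅_)

import Algebra.Properties.Semiring.Sum as SemiringSum
open import Algebra.Properties.CommutativeSemigroup (CommutativeMonoid.commutativeSemigroup ℚ.+-0-commutativeMonoid)
  using () renaming (x∙yz≈y∙xz to +-left-comm)
import Relation.Binary.Reasoning.Setoid as SetoidReasoning
open +-*-Solver

-- Finite sums

module ∑ = SemiringSum (CommutativeRing.semiring ℚ.+-*-commutativeRing)

sumℚ≡sum : ∀ {n} (f : Fin n → ℚ) → sumℚ f ≡ ∑.sum f
sumℚ≡sum {zero}  f = refl
sumℚ≡sum {suc n} f = cong (_+_ (f zero)) (sumℚ≡sum (f ∘ suc))

sumℚ-cong : ∀ {n} {f g : Fin n → ℚ} → (∀ i → f i ≡ g i) → sumℚ f ≡ sumℚ g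
sumℚ-cong {zero}  f≗g = refl
sumℚ-cong {suc n} f≗g = cong₂ _+_ (f≗g zero) (sumℚ-cong (f≗g ∘ suc))

sumℚ-zero : ∀ n → sumℚ {n} (const 0ℚ) ≡ 0ℚ
sumℚ-zero n = trans (sumℚ≡sum {n} (const 0ℚ)) (∑.sum-replicate-zero n)

sumℚ-+ : ∀ {n} (f g : Fin n → ℚ) → sumℚ (λ i → f i + g i) ≡ sumℚ f + sumℚ g
sumℚ-+ f g = begin
  sumℚ (λ i → f i + g i) ≡⟨ sumℚ≡sum (λ i → f i + g i) ⟩
  ∑.sum (λ i → f i + g i) ≡⟨ ∑.∑-distrib-+ f g ⟩
  ∑.sum f + ∑.sum g      ≡⟨ cong₂ _+_ (sumℚ≡sum f) (sumℚ≡sum g) ⟨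
  sumℚ f + sumℚ g        ∎
  where open ≡-Reasoning

sumℚ-*ˡ : ∀ {n} c (f : Fin n → ℚ) → sumℚ (λ i → c * f i) ≡ c * sumℚ f
sumℚ-*ˡ c f = begin
  sumℚ (λ i → c * f i) ≡⟨ sumℚ≡sum (λ i → c * f i) ⟩
  ∑.sum (λ i → c * f i) ≡⟨ ∑.*-distribˡ-sum c f ⟨
  c * ∑.sum f          ≡⟨ cong (c *_) (sumℚ≡sum f) ⟨
  c * sumℚ f           ∎
  where open ≡-Reasoning

sumℚ-comm : ∀ {m n} (f : Fin m → Fin n → ℚ) →
            sumℚ (λ i → sumℚ (f i)) ≡ sumℚ (λ j → sumℚ (λ i → f i j))
sumℚ-comm f = begin
  sumℚ (λ i → sumℚ (f i))                ≡⟨ sumℚ-cong (λ i → sumℚ≡sum (f i)) ⟩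
  sumℚ (λ i → ∑.sum (f i))               ≡⟨ sumℚ≡sum (λ i → ∑.sum (f i)) ⟩
  ∑.sum (λ i → ∑.sum (f i))              ≡⟨ ∑.∑-comm f ⟩
  ∑.sum (λ j → ∑.sum (λ i → f i j))      ≡⟨ sumℚ≡sum (λ j → ∑.sum (λ i → f i j)) ⟨
  sumℚ (λ j → ∑.sum (λ i → f i j))       ≡⟨ sumℚ-cong (λ j → sumℚ≡sum (λ i → f i j)) ⟨
  sumℚ (λ j → sumℚ (λ i → f i j))        ∎
  where open ≡-Reasoning

sumℚ-*ʳ : ∀ {n} c (f : Fin n → ℚ) → sumℚ (λ i → f i * c) ≡ sumℚ f * c
sumℚ-*ʳ c f = begin
  sumℚ (λ i → f i * c) ≡⟨ sumℚ-cong (λ i → ℚ.*-comm (f i) c) ⟩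
  sumℚ (λ i → c * f i) ≡⟨ sumℚ-*ˡ c f ⟩
  c * sumℚ f           ≡⟨ ℚ.*-comm c (sumℚ f) ⟩
  sumℚ f * c           ∎
  where open ≡-Reasoning

sumℚ-mono-≤ : ∀ {n} {f g : Fin n → ℚ} → (∀ i → f i ≤ g i) → sumℚ f ≤ sumℚ g
sumℚ-mono-≤ {zero}  f≤g = ℚ.≤-refl
sumℚ-mono-≤ {suc n} f≤g = ℚ.+-mono-≤ (f≤g zero) (sumℚ-mono-≤ (f≤g ∘ suc))

sumℚ-nonNeg : ∀ {n} {f : Fin n → ℚ} → (∀ i → 0ℚ ≤ f i) → 0ℚ ≤ sumℚ f
sumℚ-nonNeg {n} {f} f≥0 = subst (_≤ sumℚ f) (sumℚ-zero n) (sumℚ-mono-≤ f≥0)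

erase : ∀ {n} → (Fin n → ℚ) → Fin n → Fin n → ℚ
erase f p = updateAt f p (const 0ℚ)

erase-erases : ∀ {n} (f : Fin n → ℚ) p → erase f p p ≡ 0ℚ
erase-erases f p = Vector.updateAt-updates p f

erase-minimal : ∀ {n} (f : Fin n → ℚ) {p i} → i ≢ p → erase f p i ≡ f i
erase-minimal f {p} {i} i≢p = Vector.updateAt-minimal i p f i≢p

erase-nonNeg : ∀ {n} {f : Fin n → ℚ} p → (∀ i → 0ℚ ≤ f i) → ∀ i → 0ℚ ≤ erase f p i
erase-nonNeg {f = f} p f≥0 i with i Fin.≟ p
... | yes refl = ℚ.≤-reflexive (sym (erase-erases f p))
... | no i≢p   = subst (0ℚ ≤_) (sym (erase-minimal f i≢p)) (f≥0 i)

sumℚ-erase : ∀ {n} (f : Fin n → ℚ) p → sumℚ f ≡ f p + sumℚ (erase f p)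
sumℚ-erase {suc n} f zero    = cong (_+_ (f zero)) (sym (ℚ.+-identityˡ _))
sumℚ-erase {suc n} f (suc p) = begin
  f zero + sumℚ (f ∘ suc)                        ≡⟨ cong (_+_ (f zero)) (sumℚ-erase (f ∘ suc) p) ⟩
  f zero + (f (suc p) + sumℚ (erase (f ∘ suc) p)) ≡⟨ +-left-comm (f zero) (f (suc p)) _ ⟩
  f (suc p) + (f zero + sumℚ (erase (f ∘ suc) p)) ∎
  where open ≡-Reasoning

sumList : List ℚ → ℚ
sumList = foldr _+_ 0ℚ

map-erase : ∀ {n} (f : Fin n → ℚ) {p xs} → All (p ≢_) xs → map (erase f p) xs ≡ map f xs
map-erase f p∉xs = List.map-cong-local (All.map (λ p≢x → erase-minimal f (p≢x ∘ sym)) p∉xs)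

sumList≤sumℚ : ∀ {n} {f : Fin n → ℚ} → (∀ i → 0ℚ ≤ f i) →
               ∀ {xs} → Unique xs → sumList (map f xs) ≤ sumℚ f
sumList≤sumℚ f≥0 []                            = sumℚ-nonNeg f≥0
sumList≤sumℚ {f = f} f≥0 {x ∷ xs} (x∉xs ∷ xs!) = begin
  f x + sumList (map f xs)           ≡⟨ cong (λ ys → f x + sumList ys) (map-erase f x∉xs) ⟨
  f x + sumList (map (erase f x) xs) ≤⟨ ℚ.+-monoʳ-≤ (f x) (sumList≤sumℚ (erase-nonNeg x f≥0) xs!) ⟩
  f x + sumℚ (erase f x)             ≡⟨ sumℚ-erase f x ⟨
  sumℚ f                             ∎
  where open ℚ.≤-Reasoning

sumList≡sumℚ : ∀ {n} {f : Fin n → ℚ} {xs} → Unique xs →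
               (∀ i → All (i ≢_) xs → f i ≡ 0ℚ) → sumList (map f xs) ≡ sumℚ f
sumList≡sumℚ {n} {f} [] f≡0 = trans (sym (sumℚ-zero n)) (sumℚ-cong (λ i → sym (f≡0 i [])))
sumList≡sumℚ {f = f} {x ∷ xs} (x∉xs ∷ xs!) f≡0 = begin
  f x + sumList (map f xs)           ≡⟨ cong (λ ys → f x + sumList ys) (map-erase f x∉xs) ⟨
  f x + sumList (map (erase f x) xs) ≡⟨ cong (_+_ (f x)) (sumList≡sumℚ xs! erased≡0) ⟩
  f x + sumℚ (erase f x)             ≡⟨ sumℚ-erase f x ⟨
  sumℚ f                             ∎
  where
  open ≡-Reasoning
  erased≡0 : ∀ i → All (i ≢_) xs → erase f x i ≡ 0ℚ
  erased≡0 i i∉xs with i Fin.≟ x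
  ... | yes refl = erase-erases f x
  ... | no i≢x   = trans (erase-minimal f i≢x) (f≡0 i (i≢x ∷ i∉xs))

infix 9 _²
_² : ℚ → ℚ
x ² = x * x

²-nonNeg : ∀ x → 0ℚ ≤ x ²
²-nonNeg x with ℚ.≤-total 0ℚ x
... | inj₁ 0≤x = subst (_≤ x ²) (ℚ.*-zeroˡ x) (ℚ.*-monoʳ-≤-nonNeg x {{ℚ.nonNegative 0≤x}} 0≤x)
... | inj₂ x≤0 = subst (_≤ x ²) (ℚ.*-zeroˡ x) (ℚ.*-monoʳ-≤-nonPos x {{ℚ.nonPositive x≤0}} x≤0)

neg-² : ∀ x → (- x) ² ≡ x ²
neg-² x = solve 1 (λ x → (:- x) :* (:- x) := x :* x) refl x

-- 2 (a² + b²) = (a + b)² + (a - b)²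
1≤sum-of-squares : ∀ a b → a + b ≡ 1ℚ → 1ℚ ≤ a ² + (b ² + ((- a) ² + ((- b) ² + 0ℚ)))
1≤sum-of-squares a b a+b≡1 = begin
  1ℚ                                          ≡⟨ cong _² a+b≡1 ⟨
  (a + b) ²                                   ≡⟨ ℚ.+-identityʳ _ ⟨
  (a + b) ² + 0ℚ                              ≤⟨ ℚ.+-monoʳ-≤ ((a + b) ²) (²-nonNeg (a - b)) ⟩
  (a + b) ² + (a - b) ²                       ≡⟨ solve 2 (λ a b → (a :+ b) :* (a :+ b) :+ (a :- b) :* (a :- b)
                                                 := a :* a :+ (b :* b :+ ((:- a) :* (:- a) :+ ((:- b) :* (:- b) :+ con 0ℚ)))) refl a b ⟩
  a ² + (b ² + ((- a) ² + ((- b) ² + 0ℚ)))    ∎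
  where open ℚ.≤-Reasoning

half-of-1 : ∀ {p q} → p + q ≡ 1ℚ → p ≡ q → p ≡ ½
half-of-1 {p} {q} p+q≡1 p≡q = begin
  p             ≡⟨ solve 1 (λ p → p := (p :+ p) :* con ½) refl p ⟩
  (p + p) * ½   ≡⟨ cong (λ t → (p + t) * ½) p≡q ⟩
  (p + q) * ½   ≡⟨ cong (_* ½) p+q≡1 ⟩
  1ℚ * ½        ≡⟨⟩
  ½             ∎
  where open ≡-Reasoning

identity-diag : ∀ {n} (i : Fin n) → identity i i ≡ 1ℚ
identity-diag i with i Fin.≟ i
... | yes _   = refl
... | no i≢i = ⊥-elim (i≢i refl)

identity-≢ : ∀ {n} {i j : Fin n} → i ≢ j → identity i j ≡ 0ℚ
identity-≢ {i = i} {j} i≢j with i Fin.≟ j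
... | yes i≡j = ⊥-elim (i≢j i≡j)
... | no _    = refl

identity-comm : ∀ {n} (i j : Fin n) → identity i j ≡ identity j i
identity-comm i j = by-cases (i Fin.≟ j)
  where
  by-cases : Dec (i ≡ j) → identity i j ≡ identity j i
  by-cases (yes refl) = refl
  by-cases (no i≢j)   = trans (identity-≢ i≢j) (sym (identity-≢ (i≢j ∘ sym)))

sumℚ-*-identity : ∀ {n} (f : Fin n → ℚ) p → sumℚ (λ i → f i * identity i p) ≡ f p
sumℚ-*-identity {n} f p = begin
  sumℚ g                 ≡⟨ sumℚ-erase g p ⟩
  g p + sumℚ (erase g p) ≡⟨ cong₂ _+_ g[p]≡f[p] (trans (sumℚ-cong erased≡0) (sumℚ-zero n)) ⟩
  f p + 0ℚ               ≡⟨ ℚ.+-identityʳ (f p) ⟩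
  f p                    ∎
  where
  open ≡-Reasoning
  g : Fin n → ℚ
  g i = f i * identity i p
  g[p]≡f[p] : g p ≡ f p
  g[p]≡f[p] = trans (cong (f p *_) (identity-diag p)) (ℚ.*-identityʳ (f p))
  erased≡0 : ∀ i → erase g p i ≡ 0ℚ
  erased≡0 i with i Fin.≟ p
  ... | yes refl = erase-erases g p
  ... | no i≢p   = trans (erase-minimal g i≢p) (trans (cong (f i *_) (identity-≢ i≢p)) (ℚ.*-zeroʳ (f i)))

sumℚ-identity-* : ∀ {n} (f : Fin n → ℚ) p → sumℚ (λ i → identity p i * f i) ≡ f p
sumℚ-identity-* f p = trans (sumℚ-cong swap) (sumℚ-*-identity f p)
  where
  swap : ∀ i → identity p i * f i ≡ f i * identity i p
  swap i = trans (ℚ.*-comm (identity p i) (f i)) (cong (f i *_) (identity-comm p i))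

-- Matrices

infix 4 _≋_
_≋_ : ∀ {m n} → Mat m n → Mat m n → Set
A ≋ B = ∀ i j → A i j ≡ B i j

≋-setoid : ℕ → ℕ → Setoid 0ℓ 0ℓ
≋-setoid m n = record
  { Carrier       = Mat m n
  ; _≈_           = _≋_
  ; isEquivalence = record
    { refl  = λ _ _ → refl
    ; sym   = λ A≋B i j → sym (A≋B i j)
    ; trans = λ A≋B B≋C i j → trans (A≋B i j) (B≋C i j)
    }
  }

≋-refl : ∀ {m n} {A : Mat m n} → A ≋ A
≋-refl _ _ = refl

⊗-cong : ∀ {m n p} {A A′ : Mat m n} {B B′ : Mat n p} → A ≋ A′ → B ≋ B′ → A ⊗ B ≋ A′ ⊗ B′
⊗-cong A≋A′ B≋B′ i k = sumℚ-cong (λ j → cong₂ _*_ (A≋A′ i j) (B≋B′ j k))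

⊗-assoc : ∀ {m n p q} (A : Mat m n) (B : Mat n p) (C : Mat p q) → (A ⊗ B) ⊗ C ≋ A ⊗ (B ⊗ C)
⊗-assoc A B C i l = begin
  sumℚ (λ k → sumℚ (λ j → A i j * B j k) * C k l)   ≡⟨ sumℚ-cong (λ k → distrib k) ⟩
  sumℚ (λ k → sumℚ (λ j → A i j * (B j k * C k l))) ≡⟨ sumℚ-comm (λ k j → A i j * (B j k * C k l)) ⟩
  sumℚ (λ j → sumℚ (λ k → A i j * (B j k * C k l))) ≡⟨ sumℚ-cong (λ j → sumℚ-*ˡ (A i j) (λ k → B j k * C k l)) ⟩
  sumℚ (λ j → A i j * sumℚ (λ k → B j k * C k l))   ∎
  where
  open ≡-Reasoning
  rotate : ∀ c a b → c * (a * b) ≡ a * (b * c)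
  rotate = solve 3 (λ c a b → c :* (a :* b) := a :* (b :* c)) refl
  distrib : ∀ k → sumℚ (λ j → A i j * B j k) * C k l ≡ sumℚ (λ j → A i j * (B j k * C k l))
  distrib k = begin
    sumℚ (λ j → A i j * B j k) * C k l     ≡⟨ ℚ.*-comm _ (C k l) ⟩
    C k l * sumℚ (λ j → A i j * B j k)     ≡⟨ sumℚ-*ˡ (C k l) (λ j → A i j * B j k) ⟨
    sumℚ (λ j → C k l * (A i j * B j k))   ≡⟨ sumℚ-cong (λ j → rotate (C k l) (A i j) (B j k)) ⟩
    sumℚ (λ j → A i j * (B j k * C k l))   ∎

⊗-identityˡ : ∀ {m n} (A : Mat m n) → identity ⊗ A ≋ A
⊗-identityˡ A i k = sumℚ-identity-* (λ j → A j k) i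

⊗-identityʳ : ∀ {m n} (A : Mat m n) → A ⊗ identity ≋ A
⊗-identityʳ A i k = sumℚ-*-identity (A i) k

transpose-⊗ : ∀ {m n p} (A : Mat m n) (B : Mat n p) → transpose (A ⊗ B) ≋ transpose B ⊗ transpose A
transpose-⊗ A B i k = sumℚ-cong (λ j → ℚ.*-comm (A k j) (B j i))

transpose-identity : ∀ {n} → transpose (identity {n}) ≋ identity
transpose-identity i j = identity-comm j i

left-inverse≋right-inverse : ∀ {n} {A B C : Mat n n} → B ⊗ A ≋ identity → A ⊗ C ≋ identity → C ≋ B
left-inverse≋right-inverse {A = A} {B} {C} BA≋I AC≋I = begin
  C                ≈⟨ ⊗-identityˡ C ⟨
  identity ⊗ C     ≈⟨ ⊗-cong {B = C} BA≋I ≋-refl ⟨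
  (B ⊗ A) ⊗ C      ≈⟨ ⊗-assoc B A C ⟩
  B ⊗ (A ⊗ C)      ≈⟨ ⊗-cong {A = B} ≋-refl AC≋I ⟩
  B ⊗ identity     ≈⟨ ⊗-identityʳ B ⟩
  B                ∎
  where open SetoidReasoning (≋-setoid _ _)

gram-inverse : ∀ {n} {V W W′ : Mat n n} → V ⊗ W ≋ identity → W ⊗ V ≋ identity →
               IsInverse (V ⊗ transpose V) W′ → W′ ≋ transpose W ⊗ W
gram-inverse {n} {V} {W} VW≋I WV≋I (VVᵀW′≡I , _) = left-inverse≋right-inverse WᵀWVVᵀ≋I VVᵀW′≡I
  where
  open SetoidReasoning (≋-setoid n n)
  Vᵀ Wᵀ : Mat n n
  Vᵀ = transpose V
  Wᵀ = transpose W
  WᵀWVVᵀ≋I : (Wᵀ ⊗ W) ⊗ (V ⊗ Vᵀ) ≋ identity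
  WᵀWVVᵀ≋I = begin
    (Wᵀ ⊗ W) ⊗ (V ⊗ Vᵀ)  ≈⟨ ⊗-assoc Wᵀ W (V ⊗ Vᵀ) ⟩
    Wᵀ ⊗ (W ⊗ (V ⊗ Vᵀ))  ≈⟨ ⊗-cong {A = Wᵀ} ≋-refl (⊗-assoc W V Vᵀ) ⟨
    Wᵀ ⊗ ((W ⊗ V) ⊗ Vᵀ)  ≈⟨ ⊗-cong {A = Wᵀ} ≋-refl (⊗-cong {B = Vᵀ} WV≋I ≋-refl) ⟩
    Wᵀ ⊗ (identity ⊗ Vᵀ) ≈⟨ ⊗-cong {A = Wᵀ} ≋-refl (⊗-identityˡ Vᵀ) ⟩
    Wᵀ ⊗ Vᵀ              ≈⟨ transpose-⊗ V W ⟨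
    transpose (V ⊗ W)    ≈⟨ (λ i j → VW≋I j i) ⟩
    transpose identity   ≈⟨ transpose-identity ⟩
    identity             ∎

trace-cong : ∀ {n} {A B : Mat n n} → A ≋ B → trace A ≡ trace B
trace-cong A≋B = sumℚ-cong (λ i → A≋B i i)

trace-transpose-⊗-self : ∀ {n} (W : Mat n n) → trace (transpose W ⊗ W) ≡ sumℚ (λ k → sumℚ (λ i → W k i ²))
trace-transpose-⊗-self W = sumℚ-comm (λ i k → W k i * W k i)

-- Counting

count : ∀ {n} {P : Fin n → Set} → Decidable P → ℕ
count {zero}  P? = 0
count {suc n} P? with P? zero
... | yes _ = suc (count (P? ∘ suc))
... | no _  = count (P? ∘ suc)

count-mono : ∀ {n} {P Q : Fin n → Set} (P? : Decidable P) (Q? : Decidable Q) → P ⊆ Q → count P? ℕ.≤ count Q?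
count-mono {zero}  P? Q? P⊆Q = z≤n
count-mono {suc n} P? Q? P⊆Q with P? zero | Q? zero
... | yes _ | yes _  = s≤s (count-mono (P? ∘ suc) (Q? ∘ suc) P⊆Q)
... | yes p | no ¬q  = ⊥-elim (¬q (P⊆Q p))
... | no _  | yes _  = ℕ.m≤n⇒m≤1+n (count-mono (P? ∘ suc) (Q? ∘ suc) P⊆Q)
... | no _  | no _   = count-mono (P? ∘ suc) (Q? ∘ suc) P⊆Q

count-cong : ∀ {n} {P Q : Fin n → Set} (P? : Decidable P) (Q? : Decidable Q) → P ⊆ Q → Q ⊆ P → count P? ≡ count Q?
count-cong P? Q? P⊆Q Q⊆P = ℕ.≤-antisym (count-mono P? Q? P⊆Q) (count-mono Q? P? Q⊆P)

count-none : ∀ {n} {P : Fin n → Set} (P? : Decidable P) → (∀ i → ¬ P i) → count P? ≡ 0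
count-none {zero}  P? ¬P = refl
count-none {suc n} P? ¬P with P? zero
... | yes p = ⊥-elim (¬P zero p)
... | no _  = count-none (P? ∘ suc) (¬P ∘ suc)

count-all : ∀ {n} {P : Fin n → Set} (P? : Decidable P) → (∀ i → P i) → count P? ≡ n
count-all {zero}  P? all = refl
count-all {suc n} P? all with P? zero
... | yes _ = cong suc (count-all (P? ∘ suc) (all ∘ suc))
... | no ¬p = ⊥-elim (¬p (all zero))

count-split : ∀ {n} {P Q : Fin n → Set} (P? : Decidable P) (Q? : Decidable Q) →
              count P? ≡ count (λ i → P? i ×-dec Q? i) ℕ.+ count (λ i → P? i ×-dec ¬? (Q? i))
count-split {zero}  P? Q? = refl
count-split {suc n} P? Q? with P? zero | Q? zero
... | yes _ | yes _ = cong suc (count-split (P? ∘ suc) (Q? ∘ suc))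
... | yes _ | no _  = trans (cong suc (count-split (P? ∘ suc) (Q? ∘ suc))) (sym (ℕ.+-suc _ _))
... | no _  | yes _ = count-split (P? ∘ suc) (Q? ∘ suc)
... | no _  | no _  = count-split (P? ∘ suc) (Q? ∘ suc)

count-complement : ∀ {n} {P : Fin n → Set} (P? : Decidable P) → count P? ℕ.+ count (¬? ∘ P?) ≡ n
count-complement {zero}  P? = refl
count-complement {suc n} P? with P? zero
... | yes _ = cong suc (count-complement (P? ∘ suc))
... | no _  = trans (ℕ.+-suc _ _) (cong suc (count-complement (P? ∘ suc)))

count-≤1 : ∀ {n} {P : Fin n → Set} (P? : Decidable P) → (∀ {i j} → P i → P j → i ≡ j) → count P? ℕ.≤ 1
count-≤1 {zero}  P? unique = z≤n
count-≤1 {suc n} P? unique with P? zero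
... | yes p = s≤s (ℕ.≤-reflexive (count-none (P? ∘ suc) (λ i pᵢ → Fin.0≢1+n (unique p pᵢ))))
... | no _  = count-≤1 (P? ∘ suc) (λ pᵢ pⱼ → Fin.suc-injective (unique pᵢ pⱼ))

1≤count : ∀ {n} {P : Fin n → Set} (P? : Decidable P) {x} → P x → 1 ℕ.≤ count P?
1≤count {suc n} P? px with P? zero
... | yes _ = s≤s z≤n
1≤count {suc n} P? {zero}  px | no ¬p = ⊥-elim (¬p px)
1≤count {suc n} P? {suc x} px | no _  = 1≤count (P? ∘ suc) px

count-remove : ∀ {n} {P : Fin n → Set} (P? : Decidable P) {x} → P x →
               count P? ≡ suc (count (λ i → P? i ×-dec ¬? (i Fin.≟ x)))
count-remove {P = P} P? {x} px = begin
  count P?                  ≡⟨ count-split P? (Fin._≟ x) ⟩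
  count P=x ℕ.+ count P≠x   ≡⟨ cong (ℕ._+ count P≠x) count-P=x ⟩
  suc (count P≠x)           ∎
  where
  open ≡-Reasoning
  P≠x : ∀ i → Dec (P i × ¬ i ≡ x)
  P≠x i = P? i ×-dec ¬? (i Fin.≟ x)
  P=x : ∀ i → Dec (P i × i ≡ x)
  P=x i = P? i ×-dec (i Fin.≟ x)
  count-P=x : count P=x ≡ 1
  count-P=x = ℕ.≤-antisym (count-≤1 P=x (λ (_ , i≡x) (_ , j≡x) → trans i≡x (sym j≡x)))
                          (1≤count P=x (px , refl))

count-≤-image : ∀ {n k} {P : Fin n → Set} (P? : Decidable P) (g : Fin k → Fin n) →
                (∀ {x} → P x → ∃ λ j → g j ≡ x) → count P? ℕ.≤ k
count-≤-image {k = zero}  P? g covered = ℕ.≤-reflexive (count-none P? (λ _ p → Fin.¬Fin0 (proj₁ (covered p))))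
count-≤-image {k = suc k} {P} P? g covered = begin
  count P?                  ≡⟨ count-split P? (Fin._≟ g zero) ⟩
  count P=g₀ ℕ.+ count P≠g₀ ≤⟨ ℕ.+-mono-≤ (count-≤1 P=g₀ (λ (_ , i≡g₀) (_ , j≡g₀) → trans i≡g₀ (sym j≡g₀)))
                                         (count-≤-image P≠g₀ (g ∘ suc) covered-by-rest) ⟩
  suc k                     ∎
  where
  open ℕ.≤-Reasoning
  P=g₀ : ∀ i → Dec (P i × i ≡ g zero)
  P=g₀ i = P? i ×-dec (i Fin.≟ g zero)
  P≠g₀ : ∀ i → Dec (P i × ¬ i ≡ g zero)
  P≠g₀ i = P? i ×-dec ¬? (i Fin.≟ g zero)
  covered-by-rest : ∀ {x} → P x × ¬ x ≡ g zero → ∃ λ j → g (suc j) ≡ x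
  covered-by-rest (px , x≢g₀) with covered px
  ... | zero  , refl = ⊥-elim (x≢g₀ refl)
  ... | suc j , gj≡x = j , gj≡x

count≡0⇒∄ : ∀ {n} {P : Fin n → Set} (P? : Decidable P) → count P? ≡ 0 → ∀ i → ¬ P i
count≡0⇒∄ P? count≡0 i pᵢ = ℕ.<⇒≢ (1≤count P? pᵢ) (sym count≡0)

∃-of-count≡suc : ∀ {n k} {P : Fin n → Set} (P? : Decidable P) → count P? ≡ suc k → ∃ P
∃-of-count≡suc P? count≡1+k with Fin.any? P?
... | yes ∃P = ∃P
... | no ∄P  = ⊥-elim (ℕ.0≢1+n (trans (sym (count-none P? (λ i pᵢ → ∄P (i , pᵢ)))) count≡1+k))

count-< : ∀ {n} {P Q : Fin n → Set} (P? : Decidable P) (Q? : Decidable Q) {x} →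
          P ⊆ Q → Q x → ¬ P x → suc (count P?) ℕ.≤ count Q?
count-< {P = P} {Q} P? Q? {x} P⊆Q qx ¬px = begin
  suc (count P?)                                ≤⟨ s≤s (count-mono P? (λ i → Q? i ×-dec ¬? (i Fin.≟ x)) P⊆Q∖x) ⟩
  suc (count (λ i → Q? i ×-dec ¬? (i Fin.≟ x)))  ≡⟨ count-remove Q? qx ⟨
  count Q?                                      ∎
  where
  open ℕ.≤-Reasoning
  P⊆Q∖x : P ⊆ (λ i → Q i × ¬ i ≡ x)
  P⊆Q∖x pᵢ = P⊆Q pᵢ , λ i≡x → ¬px (subst P i≡x pᵢ)

least : ∀ {n} {P : Fin n → Set} → Decidable P → ∀ {x} → P x → ∃ λ y → P y × ∀ {z} → P z → y Fin.≤ z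
least {suc n} P? px with P? zero
... | yes p₀ = zero , p₀ , λ _ → z≤n
least {suc n} P? {zero}  px | no ¬p₀ = ⊥-elim (¬p₀ px)
least {suc n} {P} P? {suc x} px | no ¬p₀ with least (P? ∘ suc) px
... | y , py , y-least = suc y , py , suc-least
  where
  suc-least : ∀ {z} → P z → suc y Fin.≤ z
  suc-least {zero}  p₀ = ⊥-elim (¬p₀ p₀)
  suc-least {suc z} pz = s≤s (y-least pz)

injective⇒onto : ∀ {m n} (g : Fin m → Fin n) → Injective _≡_ _≡_ g → m ≡ n → ∀ y → ∃ λ x → g x ≡ y
injective⇒onto {n = suc n} g g-injective refl y with Fin.any? (λ x → g x Fin.≟ y)
... | yes hit = hit
... | no miss = ⊥-elim (ℕ.1+n≰n (Fin.injective⇒≤ punched-injective))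
  where
  y≢g : ∀ x → y ≢ g x
  y≢g x y≡gx = miss (x , sym y≡gx)
  punched : Fin (suc n) → Fin n
  punched x = Fin.punchOut (y≢g x)
  punched-injective : Injective _≡_ _≡_ punched
  punched-injective {x} {x′} eq = g-injective (Fin.punchOut-injective (y≢g x) (y≢g x′) eq)

fromℕ : ℕ → ℚ
fromℕ n = + n / 1

toℚᵘ-fromℕ : ∀ n → toℚᵘ (fromℕ n) ℚᵘ.≃ mkℚᵘ (+ n) 0
toℚᵘ-fromℕ n = ℚ.toℚᵘ-fromℚᵘ (mkℚᵘ (+ n) 0)

fromℕ-+ : ∀ m n → fromℕ (m ℕ.+ n) ≡ fromℕ m + fromℕ n
fromℕ-+ m n = ℚ.toℚᵘ-injective (begin
  toℚᵘ (fromℕ (m ℕ.+ n))             ≈⟨ toℚᵘ-fromℕ (m ℕ.+ n) ⟩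
  mkℚᵘ (+ (m ℕ.+ n)) 0               ≈⟨ *≡* (cong (ℤ._* + 1) m+n≡m1+n1) ⟩
  mkℚᵘ (+ m) 0 ℚᵘ.+ mkℚᵘ (+ n) 0      ≈⟨ ℚᵘ.+-cong (toℚᵘ-fromℕ m) (toℚᵘ-fromℕ n) ⟨
  toℚᵘ (fromℕ m) ℚᵘ.+ toℚᵘ (fromℕ n)  ≈⟨ ℚ.toℚᵘ-homo-+ (fromℕ m) (fromℕ n) ⟨
  toℚᵘ (fromℕ m + fromℕ n)           ∎)
  where
  open ℚᵘ.≃-Reasoning
  m+n≡m1+n1 : + (m ℕ.+ n) ≡ + m ℤ.* + 1 ℤ.+ + n ℤ.* + 1
  m+n≡m1+n1 = trans (ℤ.pos-+ m n) (sym (cong₂ ℤ._+_ (ℤ.*-identityʳ (+ m)) (ℤ.*-identityʳ (+ n))))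

fromℕ-* : ∀ m n → fromℕ (m ℕ.* n) ≡ fromℕ m * fromℕ n
fromℕ-* zero    n = sym (ℚ.*-zeroˡ (fromℕ n))
fromℕ-* (suc m) n = begin
  fromℕ (n ℕ.+ m ℕ.* n)           ≡⟨ fromℕ-+ n (m ℕ.* n) ⟩
  fromℕ n + fromℕ (m ℕ.* n)       ≡⟨ cong (_+_ (fromℕ n)) (fromℕ-* m n) ⟩
  fromℕ n + fromℕ m * fromℕ n     ≡⟨ solve 2 (λ a b → b :+ a :* b := (con 1ℚ :+ a) :* b) refl (fromℕ m) (fromℕ n) ⟩
  (1ℚ + fromℕ m) * fromℕ n        ≡⟨ cong (_* fromℕ n) (fromℕ-+ 1 m) ⟨
  fromℕ (suc m) * fromℕ n         ∎
  where open ≡-Reasoning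

fromℕ-injective : ∀ {m n} → fromℕ m ≡ fromℕ n → m ≡ n
fromℕ-injective {m} {n} eq with begin
    mkℚᵘ (+ m) 0     ≈⟨ toℚᵘ-fromℕ m ⟨
    toℚᵘ (fromℕ m)  ≡⟨ cong toℚᵘ eq ⟩
    toℚᵘ (fromℕ n)  ≈⟨ toℚᵘ-fromℕ n ⟩
    mkℚᵘ (+ n) 0     ∎
  where open ℚᵘ.≃-Reasoning
... | *≡* m*1≡n*1 = ℤ.+-injective (begin
  + m          ≡⟨ ℤ.*-identityʳ (+ m) ⟨
  + m ℤ.* + 1  ≡⟨ m*1≡n*1 ⟩
  + n ℤ.* + 1  ≡⟨ ℤ.*-identityʳ (+ n) ⟩
  + n          ∎)
  where open ≡-Reasoning

fromℕ-nonNeg : ∀ n → 0ℚ ≤ fromℕ n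
fromℕ-nonNeg n = ℚ.nonNegative⁻¹ (fromℕ n) {{ℚ.normalize-nonNeg n 1}}

fromℕ-mono-≤ : ∀ {m n} → m ℕ.≤ n → fromℕ m ≤ fromℕ n
fromℕ-mono-≤ {m} m≤n with ℕ.m≤n⇒∃[o]m+o≡n m≤n
... | o , refl = begin
  fromℕ m             ≡⟨ ℚ.+-identityʳ (fromℕ m) ⟨
  fromℕ m + 0ℚ        ≤⟨ ℚ.+-monoʳ-≤ (fromℕ m) (fromℕ-nonNeg o) ⟩
  fromℕ m + fromℕ o   ≡⟨ fromℕ-+ m o ⟨
  fromℕ (m ℕ.+ o)     ∎
  where open ℚ.≤-Reasoning

/-as-* : ∀ n k → + n / suc k ≡ fromℕ n * (+ 1 / suc k)
/-as-* n k = ℚ.toℚᵘ-injective (begin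
  toℚᵘ (+ n / suc k)                        ≈⟨ ℚ.toℚᵘ-fromℚᵘ (mkℚᵘ (+ n) k) ⟩
  mkℚᵘ (+ n) k                              ≈⟨ *≡* n[1+k]≡n1[1+k] ⟩
  mkℚᵘ (+ n) 0 ℚᵘ.* mkℚᵘ (+ 1) k             ≈⟨ ℚᵘ.*-cong (toℚᵘ-fromℕ n) (ℚ.toℚᵘ-fromℚᵘ (mkℚᵘ (+ 1) k)) ⟨
  toℚᵘ (fromℕ n) ℚᵘ.* toℚᵘ (+ 1 / suc k)     ≈⟨ ℚ.toℚᵘ-homo-* (fromℕ n) (+ 1 / suc k) ⟨
  toℚᵘ (fromℕ n * (+ 1 / suc k))            ∎)
  where
  open ℚᵘ.≃-Reasoning
  n[1+k]≡n1[1+k] : + n ℤ.* + (1 ℕ.* suc k) ≡ (+ n ℤ.* + 1) ℤ.* + suc k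
  n[1+k]≡n1[1+k] = cong₂ ℤ._*_ (sym (ℤ.*-identityʳ (+ n))) (cong +_ (ℕ.*-identityˡ (suc k)))

sumℚ-const : ∀ n c → sumℚ {n} (const c) ≡ fromℕ n * c
sumℚ-const zero    c = sym (ℚ.*-zeroˡ c)
sumℚ-const (suc n) c = begin
  c + sumℚ {n} (const c)   ≡⟨ cong (_+_ c) (sumℚ-const n c) ⟩
  c + fromℕ n * c          ≡⟨ solve 2 (λ a c → c :+ a :* c := (con 1ℚ :+ a) :* c) refl (fromℕ n) c ⟩
  (1ℚ + fromℕ n) * c       ≡⟨ cong (_* c) (fromℕ-+ 1 n) ⟨
  fromℕ (suc n) * c        ∎
  where open ≡-Reasoning

indicator : ∀ {A : Set} → Dec A → ℚ
indicator (yes _) = 1ℚ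
indicator (no _)  = 0ℚ

sumℚ-indicator : ∀ {n} {P : Fin n → Set} (P? : Decidable P) → sumℚ (indicator ∘ P?) ≡ fromℕ (count P?)
sumℚ-indicator {zero}  P? = refl
sumℚ-indicator {suc n} P? with P? zero
... | yes _ = trans (cong (_+_ 1ℚ) (sumℚ-indicator (P? ∘ suc))) (sym (fromℕ-+ 1 (count (P? ∘ suc))))
... | no _  = trans (ℚ.+-identityˡ _) (sumℚ-indicator (P? ∘ suc))

indicator-yes : ∀ {A : Set} (A? : Dec A) → A → indicator A? ≡ 1ℚ
indicator-yes (yes _) _ = refl
indicator-yes (no ¬a) a = ⊥-elim (¬a a)

indicator-no : ∀ {A : Set} (A? : Dec A) → ¬ A → indicator A? ≡ 0ℚ
indicator-no (yes a) ¬a = ⊥-elim (¬a a)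
indicator-no (no _)  _  = refl

indicator-cong : ∀ {A B : Set} (A? : Dec A) (B? : Dec B) → A ⇔ B → indicator A? ≡ indicator B?
indicator-cong (yes _) (yes _) A⇔B = refl
indicator-cong (no _)  (no _)  A⇔B = refl
indicator-cong (yes a) (no ¬b) A⇔B = ⊥-elim (¬b (Equivalence.to A⇔B a))
indicator-cong (no ¬a) (yes b) A⇔B = ⊥-elim (¬a (Equivalence.from A⇔B b))

sumℚ-indicator-*-diag : ∀ {n} {P : Fin n → Set} (P? : Decidable P) {M : Mat n n} → M ≋ identity →
                        sumℚ (λ i → indicator (P? i) * M i i) ≡ fromℕ (count P?)
sumℚ-indicator-*-diag P? M≋I = trans (sumℚ-cong (λ i → trans (cong (indicator (P? i) *_) (trans (M≋I i i) (identity-diag i)))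
                                                               (ℚ.*-identityʳ _)))
                                     (sumℚ-indicator P?)

count-≡-of-inverse : ∀ {n} {A B : Mat n n} → A ⊗ B ≋ identity → B ⊗ A ≋ identity →
                     ∀ {P Q : Fin n → Set} (P? : Decidable P) (Q? : Decidable Q) →
                     (∀ i k → A i k ≡ 0ℚ ⊎ (P i ⇔ Q k)) → count P? ≡ count Q?
count-≡-of-inverse {A = A} {B} AB≋I BA≋I P? Q? P⇔Q = fromℕ-injective (begin
  fromℕ (count P?)
    ≡⟨ sumℚ-indicator-*-diag P? AB≋I ⟨
  sumℚ (λ i → indicator (P? i) * (A ⊗ B) i i)
    ≡⟨ sumℚ-cong (λ i → sumℚ-*ˡ (indicator (P? i)) (λ k → A i k * B k i)) ⟨
  sumℚ (λ i → sumℚ (λ k → indicator (P? i) * (A i k * B k i)))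
    ≡⟨ sumℚ-cong (λ i → sumℚ-cong (λ k → P-weight≡Q-weight i k)) ⟩
  sumℚ (λ i → sumℚ (λ k → indicator (Q? k) * (A i k * B k i)))
    ≡⟨ sumℚ-comm (λ i k → indicator (Q? k) * (A i k * B k i)) ⟩
  sumℚ (λ k → sumℚ (λ i → indicator (Q? k) * (A i k * B k i)))
    ≡⟨ sumℚ-cong (λ k → sumℚ-cong (λ i → cong (indicator (Q? k) *_) (ℚ.*-comm (A i k) (B k i)))) ⟩
  sumℚ (λ k → sumℚ (λ i → indicator (Q? k) * (B k i * A i k)))
    ≡⟨ sumℚ-cong (λ k → sumℚ-*ˡ (indicator (Q? k)) (λ i → B k i * A i k)) ⟩
  sumℚ (λ k → indicator (Q? k) * (B ⊗ A) k k)
    ≡⟨ sumℚ-indicator-*-diag Q? BA≋I ⟩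
  fromℕ (count Q?)
    ∎)
  where
  open ≡-Reasoning
  P-weight≡Q-weight : ∀ i k → indicator (P? i) * (A i k * B k i) ≡ indicator (Q? k) * (A i k * B k i)
  P-weight≡Q-weight i k with P⇔Q i k
  ... | inj₂ Pᵢ⇔Qₖ = cong (_* (A i k * B k i)) (indicator-cong (P? i) (Q? k) Pᵢ⇔Qₖ)
  ... | inj₁ Aᵢₖ≡0 = begin
    indicator (P? i) * (A i k * B k i)
      ≡⟨ cong (λ a → indicator (P? i) * (a * B k i)) Aᵢₖ≡0 ⟩
    indicator (P? i) * (0ℚ * B k i)
      ≡⟨ solve 2 (λ p q → p :* (con 0ℚ :* q) := con 0ℚ) refl (indicator (P? i)) (B k i) ⟩
    0ℚ
      ≡⟨ solve 2 (λ p q → p :* (con 0ℚ :* q) := con 0ℚ) refl (indicator (Q? k)) (B k i) ⟨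
    indicator (Q? k) * (0ℚ * B k i)
      ≡⟨ cong (λ a → indicator (Q? k) * (a * B k i)) Aᵢₖ≡0 ⟨
    indicator (Q? k) * (A i k * B k i) ∎

-- Reachability in the graph ([d], S)

module Graph {d m : ℕ} (S : Fin m → Edge d) where

  src tgt : Fin m → Fin d
  src k = proj₁ (S k)
  tgt k = proj₁ (proj₂ (S k))

  src≢tgt : ∀ k → src k ≢ tgt k
  src≢tgt k src≡tgt = Fin.<-irrefl src≡tgt (proj₂ (proj₂ (S k)))

  src∈ₑ : ∀ k → src k ∈ₑ S k
  src∈ₑ k = inj₁ refl

  tgt∈ₑ : ∀ k → tgt k ∈ₑ S k
  tgt∈ₑ k = inj₂ refl

  _∈ₑ?_ : ∀ u k → Dec (u ∈ₑ S k)
  u ∈ₑ? k = (u Fin.≟ src k) ⊎-dec (u Fin.≟ tgt k)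

  Joins : Fin m → Fin d → Fin d → Set
  Joins l x w = ends (S l) ≡ (x , w) ⊎ ends (S l) ≡ (w , x)

  Joins-sym : ∀ {l x w} → Joins l x w → Joins l w x
  Joins-sym (inj₁ eq) = inj₂ eq
  Joins-sym (inj₂ eq) = inj₁ eq

  Joins-∈ₑ : ∀ {l x w} → Joins l x w → x ∈ₑ S l × w ∈ₑ S l
  Joins-∈ₑ (inj₁ refl) = inj₁ refl , inj₂ refl
  Joins-∈ₑ (inj₂ refl) = inj₂ refl , inj₁ refl

  Joins-≢ : ∀ {l x w} → Joins l x w → x ≢ w
  Joins-≢ {l} (inj₁ refl) = src≢tgt l
  Joins-≢ {l} (inj₂ refl) = src≢tgt l ∘ sym

  Joins-other-end : ∀ {l x w w′} → Joins l x w → Joins l x w′ → w ≡ w′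
  Joins-other-end {l} (inj₁ refl) (inj₁ eq) = cong proj₂ eq
  Joins-other-end {l} (inj₁ refl) (inj₂ eq) = ⊥-elim (src≢tgt l (sym (cong proj₂ eq)))
  Joins-other-end {l} (inj₂ refl) (inj₁ eq) = ⊥-elim (src≢tgt l (cong proj₁ eq))
  Joins-other-end {l} (inj₂ refl) (inj₂ eq) = cong proj₁ eq

  ∈ₑ-Joins : ∀ {l x w u} → Joins l x w → u ∈ₑ S l → u ≡ x ⊎ u ≡ w
  ∈ₑ-Joins (inj₁ refl) u∈l = u∈l
  ∈ₑ-Joins (inj₂ refl) (inj₁ u≡w) = inj₂ u≡w
  ∈ₑ-Joins (inj₂ refl) (inj₂ u≡x) = inj₁ u≡x

  other-end : ∀ {l x} → x ∈ₑ S l → ∃ λ w → Joins l x w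
  other-end {l} (inj₁ refl) = tgt l , inj₁ refl
  other-end {l} (inj₂ refl) = src l , inj₂ refl

  Joins-unique : (∀ k l → ends (S k) ≡ ends (S l) → k ≡ l) → ∀ {k l x w} → Joins k x w → Joins l x w → k ≡ l
  Joins-unique S-injective {k} {l} (inj₁ eqₖ) (inj₁ eqₗ) = S-injective k l (trans eqₖ (sym eqₗ))
  Joins-unique S-injective {k} {l} (inj₂ eqₖ) (inj₂ eqₗ) = S-injective k l (trans eqₖ (sym eqₗ))
  Joins-unique S-injective {k} {l} (inj₁ refl) (inj₂ eqₗ) =
    ⊥-elim (Fin.<-asym (proj₂ (proj₂ (S k))) (subst₂ Fin._<_ (cong proj₁ eqₗ) (cong proj₂ eqₗ) (proj₂ (proj₂ (S l)))))
  Joins-unique S-injective {k} {l} (inj₂ refl) (inj₁ eqₗ) =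
    ⊥-elim (Fin.<-asym (proj₂ (proj₂ (S k))) (subst₂ Fin._<_ (cong proj₁ eqₗ) (cong proj₂ eqₗ) (proj₂ (proj₂ (S l)))))

  infixl 6 _∖_
  _∖_ : EdgeSet m → Fin m → EdgeSet m
  (T ∖ e) k = T k × k ≢ e

  _∖?_ : ∀ {T} → Decidable T → ∀ e → Decidable (T ∖ e)
  (T? ∖? e) k = T? k ×-dec ¬? (k Fin.≟ e)

  ∖-⊆ : ∀ {T e} → T ∖ e ⊆ T
  ∖-⊆ = proj₁

  ⊆-∖-∪ : ∀ {T e} → T ⊆ (λ k → (T ∖ e) k ⊎ k ≡ e)
  ⊆-∖-∪ {e = e} {k} tₖ with k Fin.≟ e
  ... | yes k≡e = inj₂ k≡e
  ... | no k≢e  = inj₁ (tₖ , k≢e)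

  count-∖≡ : ∀ {T e n} (T? : Decidable T) → T e → count T? ≡ suc n → count (T? ∖? e) ≡ n
  count-∖≡ T? tₑ count≡1+n = ℕ.suc-injective (trans (sym (count-remove T? tₑ)) count≡1+n)

  Adj-edge : ∀ {T k} → T k → Adj S T (src k) (tgt k)
  Adj-edge {k = k} tₖ = k , tₖ , inj₁ refl

  Adj-sym : ∀ {T u v} → Adj S T u v → Adj S T v u
  Adj-sym (k , tₖ , inj₁ eq) = k , tₖ , inj₂ eq
  Adj-sym (k , tₖ , inj₂ eq) = k , tₖ , inj₁ eq

  Adj-mono : ∀ {T T′} → T ⊆ T′ → ∀ {u v} → Adj S T u v → Adj S T′ u v
  Adj-mono T⊆T′ (k , tₖ , eq) = k , T⊆T′ tₖ , eq

  Reach-sym : ∀ {T u v} → Reach S T u v → Reach S T v u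
  Reach-sym = Star.reverse Adj-sym

  Reach-mono : ∀ {T T′} → T ⊆ T′ → ∀ {u v} → Reach S T u v → Reach S T′ u v
  Reach-mono T⊆T′ = Star.map (Adj-mono T⊆T′)

  Reach-edge : ∀ {T k} → T k → Reach S T (src k) (tgt k)
  Reach-edge tₖ = Adj-edge tₖ ◅ ε

  Reach-empty : ∀ {T} → (∀ k → ¬ T k) → ∀ {u v} → Reach S T u v → u ≡ v
  Reach-empty ∄T ε                 = refl
  Reach-empty ∄T ((k , tₖ , _) ◅ _) = ⊥-elim (∄T k tₖ)

  -- After shortcutting, a walk in T with e added avoids e or crosses it once.
  ViaEdge : EdgeSet m → Fin m → Fin d → Fin d → Set
  ViaEdge T e u v = Reach S T u v
                  ⊎ (Reach S T u (src e) × Reach S T (tgt e) v)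
                  ⊎ (Reach S T u (tgt e) × Reach S T (src e) v)

  private
    ViaEdge-◅◅ : ∀ {T e u w v} → Reach S T u w → ViaEdge T e w v → ViaEdge T e u v
    ViaEdge-◅◅ p (inj₁ q)               = inj₁ (p ◅◅ q)
    ViaEdge-◅◅ p (inj₂ (inj₁ (q , r))) = inj₂ (inj₁ (p ◅◅ q , r))
    ViaEdge-◅◅ p (inj₂ (inj₂ (q , r))) = inj₂ (inj₂ (p ◅◅ q , r))

    ViaEdge-src : ∀ {T e v} → ViaEdge T e (tgt e) v → ViaEdge T e (src e) v
    ViaEdge-src (inj₁ q)               = inj₂ (inj₁ (ε , q))
    ViaEdge-src (inj₂ (inj₁ (q , r))) = inj₁ (Reach-sym q ◅◅ r)
    ViaEdge-src (inj₂ (inj₂ (_ , r))) = inj₁ r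

    ViaEdge-tgt : ∀ {T e v} → ViaEdge T e (src e) v → ViaEdge T e (tgt e) v
    ViaEdge-tgt (inj₁ q)               = inj₂ (inj₂ (ε , q))
    ViaEdge-tgt (inj₂ (inj₁ (_ , r))) = inj₁ r
    ViaEdge-tgt (inj₂ (inj₂ (q , r))) = inj₁ (Reach-sym q ◅◅ r)

  Reach⇒ViaEdge : ∀ {T T′ e} → T′ ⊆ (λ k → T k ⊎ k ≡ e) → ∀ {u v} → Reach S T′ u v → ViaEdge T e u v
  Reach⇒ViaEdge T′⊆T+e ε = inj₁ ε
  Reach⇒ViaEdge T′⊆T+e ((k , t′ₖ , ends) ◅ p) with T′⊆T+e t′ₖ | Reach⇒ViaEdge T′⊆T+e p
  ... | inj₁ tₖ   | via = ViaEdge-◅◅ ((k , tₖ , ends) ◅ ε) via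
  ... | inj₂ refl | via with ends
  ...   | inj₁ refl = ViaEdge-src via
  ...   | inj₂ refl = ViaEdge-tgt via

  ViaEdge⇒Reach : ∀ {T T′ e} → T ⊆ T′ → T′ e → ∀ {u v} → ViaEdge T e u v → Reach S T′ u v
  ViaEdge⇒Reach T⊆T′ t′ₑ (inj₁ p)               = Reach-mono T⊆T′ p
  ViaEdge⇒Reach T⊆T′ t′ₑ (inj₂ (inj₁ (p , q))) = Reach-mono T⊆T′ p ◅◅ Reach-edge t′ₑ ◅◅ Reach-mono T⊆T′ q
  ViaEdge⇒Reach T⊆T′ t′ₑ (inj₂ (inj₂ (p , q))) = Reach-mono T⊆T′ p ◅◅ Reach-sym (Reach-edge t′ₑ) ◅◅ Reach-mono T⊆T′ q

  Reach-bypass : ∀ {T T′ e} → T′ ⊆ (λ k → T k ⊎ k ≡ e) → Reach S T (src e) (tgt e) →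
                 ∀ {u v} → Reach S T′ u v → Reach S T u v
  Reach-bypass T′⊆T+e ends-joined p with Reach⇒ViaEdge T′⊆T+e p
  ... | inj₁ q               = q
  ... | inj₂ (inj₁ (q , r)) = q ◅◅ ends-joined ◅◅ r
  ... | inj₂ (inj₂ (q , r)) = q ◅◅ Reach-sym ends-joined ◅◅ r

  Reach? : ∀ {T} → Decidable T → ∀ u v → Dec (Reach S T u v)
  Reach? T? = by-count (count T?) T? refl
    where
    by-count : ∀ n {T} (T? : Decidable T) → count T? ≡ n → ∀ u v → Dec (Reach S T u v)
    by-count zero T? count≡0 u v =
      map′ (λ { refl → ε }) (Reach-empty (count≡0⇒∄ T? count≡0)) (u Fin.≟ v)
    by-count (suc n) {T} T? count≡1+n u v with ∃-of-count≡suc T? count≡1+n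
    ... | e , tₑ = map′ (ViaEdge⇒Reach {T ∖ e} {T} (∖-⊆ {T}) tₑ) (Reach⇒ViaEdge (⊆-∖-∪ {T}))
                        (Reach∖? u v ⊎-dec ((Reach∖? u (src e) ×-dec Reach∖? (tgt e) v)
                                        ⊎-dec (Reach∖? u (tgt e) ×-dec Reach∖? (src e) v)))
      where
      Reach∖? : ∀ u v → Dec (Reach S (T ∖ e) u v)
      Reach∖? = by-count n (T? ∖? e) (count-∖≡ T? tₑ count≡1+n)

  -- A root is the least vertex of its component, so roots count components.
  Root : EdgeSet m → Fin d → Set
  Root T u = ∀ v → Reach S T u v → u Fin.≤ v

  Root? : ∀ {T} → Decidable T → Decidable (Root T)
  Root? T? u = Fin.all? (λ v → Reach? T? u v →-dec (u Fin.≤? v))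

  #components : ∀ {T} → Decidable T → ℕ
  #components T? = count (Root? T?)

  Root-unique : ∀ {T u v} → Root T u → Root T v → Reach S T u v → u ≡ v
  Root-unique {u = u} {v} root-u root-v p = Fin.≤-antisym (root-u v p) (root-v u (Reach-sym p))

  Root-antimono : ∀ {T T′} → T ⊆ T′ → Root T′ ⊆ Root T
  Root-antimono T⊆T′ root v p = root v (Reach-mono T⊆T′ p)

  Reach-Root : ∀ {T} → Decidable T → ∀ u → ∃ λ r → Reach S T u r × Root T r
  Reach-Root T? u with least (Reach? T? u) ε
  ... | r , u~r , r-least = r , u~r , λ v r~v → r-least (u~r ◅◅ r~v)

  ¬Root⇒smaller : ∀ {T} → Decidable T → ∀ {u} → ¬ Root T u → ∃ λ v → Reach S T u v × v Fin.< u
  ¬Root⇒smaller T? {u} ¬root with Fin.any? (λ v → Reach? T? u v ×-dec (v Fin.<? u))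
  ... | yes smaller = smaller
  ... | no ∄smaller = ⊥-elim (¬root (λ v u~v → ℕ.≮⇒≥ (λ v<u → ∄smaller (v , u~v , v<u))))

  #components-empty : ∀ {T} (T? : Decidable T) → (∀ k → ¬ T k) → #components T? ≡ d
  #components-empty T? ∄T = count-all (Root? T?) (λ u v u~v → Fin.≤-reflexive (Reach-empty ∄T u~v))

  private
    -- how a root of T ∖ e reaches a smaller vertex once e is put back
    Side : EdgeSet m → Fin m → Fin d → Set
    Side T e u = (Reach S (T ∖ e) u (src e) × ∃ λ v → Reach S (T ∖ e) (tgt e) v × v Fin.< u)
               ⊎ (Reach S (T ∖ e) u (tgt e) × ∃ λ v → Reach S (T ∖ e) (src e) v × v Fin.< u)

    lost-root-Side : ∀ {T} (T? : Decidable T) e {u} → Root (T ∖ e) u → ¬ Root T u → Side T e u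
    lost-root-Side {T} T? e root ¬root with ¬Root⇒smaller T? ¬root
    ... | v , u~v , v<u with Reach⇒ViaEdge (⊆-∖-∪ {T}) u~v
    ...   | inj₁ u~v∖e           = ⊥-elim (ℕ.<⇒≱ v<u (root v u~v∖e))
    ...   | inj₂ (inj₁ (p , q)) = inj₁ (p , v , q , v<u)
    ...   | inj₂ (inj₂ (p , q)) = inj₂ (p , v , q , v<u)

    crossed : ∀ {T u u′ x y v v′} → Root T u → Root T u′ →
              Reach S T u x → Reach S T x v′ → v′ Fin.< u′ →
              Reach S T u′ y → Reach S T y v → v Fin.< u → ⊥
    crossed {v = v} {v′} root root′ u~x x~v′ v′<u′ u′~y y~v v<u =
      ℕ.<-irrefl refl (ℕ.<-≤-trans v<u (ℕ.≤-trans (root v′ (u~x ◅◅ x~v′))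
                                                  (ℕ.<⇒≤ (ℕ.<-≤-trans v′<u′ (root′ v (u′~y ◅◅ y~v))))))

    Side-unique : ∀ {T e u u′} → Root (T ∖ e) u → Root (T ∖ e) u′ → Side T e u → Side T e u′ → u ≡ u′
    Side-unique root root′ (inj₁ (p , _)) (inj₁ (p′ , _)) = Root-unique root root′ (p ◅◅ Reach-sym p′)
    Side-unique root root′ (inj₂ (p , _)) (inj₂ (p′ , _)) = Root-unique root root′ (p ◅◅ Reach-sym p′)
    Side-unique root root′ (inj₁ (p , v , q , v<u)) (inj₂ (p′ , v′ , q′ , v′<u′)) =
      ⊥-elim (crossed root root′ p q′ v′<u′ p′ q v<u)
    Side-unique root root′ (inj₂ (p , v , q , v<u)) (inj₁ (p′ , v′ , q′ , v′<u′)) =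
      ⊥-elim (crossed root root′ p q′ v′<u′ p′ q v<u)

  #components-∖ : ∀ {T} (T? : Decidable T) e → #components (T? ∖? e) ℕ.≤ suc (#components T?)
  #components-∖ {T} T? e = begin
    count (Root? (T? ∖? e))          ≡⟨ count-split (Root? (T? ∖? e)) (Root? T?) ⟩
    count kept ℕ.+ count lost        ≤⟨ ℕ.+-mono-≤ (count-mono kept (Root? T?) proj₂) lost≤1 ⟩
    #components T? ℕ.+ 1             ≡⟨ ℕ.+-comm (#components T?) 1 ⟩
    suc (#components T?)             ∎
    where
    open ℕ.≤-Reasoning
    kept : Decidable (λ u → Root (T ∖ e) u × Root T u)
    kept u = Root? (T? ∖? e) u ×-dec Root? T? u
    lost : Decidable (λ u → Root (T ∖ e) u × ¬ Root T u)
    lost u = Root? (T? ∖? e) u ×-dec ¬? (Root? T? u)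
    lost≤1 : count lost ℕ.≤ 1
    lost≤1 = count-≤1 lost (λ (root , ¬root) (root′ , ¬root′) →
      Side-unique root root′ (lost-root-Side T? e root ¬root) (lost-root-Side T? e root′ ¬root′))

  #components-bridge : ∀ {T e} (T? : Decidable T) → T e → ¬ Reach S (T ∖ e) (src e) (tgt e) →
                       suc (#components T?) ℕ.≤ #components (T? ∖? e)
  #components-bridge {T} {e} T? tₑ ¬joined
    with Reach-Root (T? ∖? e) (src e) | Reach-Root (T? ∖? e) (tgt e)
  ... | a , src~a , root-a | b , tgt~b , root-b with Fin.<-cmp a b
  ...   | tri≈ _ refl _ = ⊥-elim (¬joined (src~a ◅◅ Reach-sym tgt~b))
  ...   | tri< a<b _ _  = count-< (Root? T?) (Root? (T? ∖? e)) (Root-antimono (∖-⊆ {T})) root-b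
                            (λ root → ℕ.<⇒≱ a<b (root a (Reach-mono (∖-⊆ {T}) (Reach-sym tgt~b)
                                                        ◅◅ Reach-sym (Reach-edge tₑ) ◅◅ Reach-mono (∖-⊆ {T}) src~a)))
  ...   | tri> _ _ b<a  = count-< (Root? T?) (Root? (T? ∖? e)) (Root-antimono (∖-⊆ {T})) root-a
                            (λ root → ℕ.<⇒≱ b<a (root b (Reach-mono (∖-⊆ {T}) (Reach-sym src~a)
                                                        ◅◅ Reach-edge tₑ ◅◅ Reach-mono (∖-⊆ {T}) tgt~b)))

  d≤#components+count : ∀ {T} (T? : Decidable T) → d ℕ.≤ #components T? ℕ.+ count T?
  d≤#components+count T? = by-count (count T?) T? refl
    where
    by-count : ∀ n {T} (T? : Decidable T) → count T? ≡ n → d ℕ.≤ #components T? ℕ.+ n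
    by-count zero    T? count≡0 = ℕ.≤-reflexive (sym (trans (ℕ.+-identityʳ _)
                                    (#components-empty T? (count≡0⇒∄ T? count≡0))))
    by-count (suc n) T? count≡1+n with ∃-of-count≡suc T? count≡1+n
    ... | e , tₑ = begin
      d                                ≤⟨ by-count n (T? ∖? e) (count-∖≡ T? tₑ count≡1+n) ⟩
      #components (T? ∖? e) ℕ.+ n      ≤⟨ ℕ.+-monoˡ-≤ n (#components-∖ T? e) ⟩
      suc (#components T?) ℕ.+ n       ≡⟨ ℕ.+-suc (#components T?) n ⟨
      #components T? ℕ.+ suc n         ∎
      where open ℕ.≤-Reasoning

  CycleEdge : EdgeSet m → Fin m → Set
  CycleEdge T e = T e × Reach S (T ∖ e) (src e) (tgt e)

  cycleEdge-or-forest : ∀ {T} (T? : Decidable T) → ∃ (CycleEdge T) ⊎ #components T? ℕ.+ count T? ℕ.≤ d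
  cycleEdge-or-forest T? = by-count (count T?) T? refl
    where
    by-count : ∀ n {T} (T? : Decidable T) → count T? ≡ n → ∃ (CycleEdge T) ⊎ #components T? ℕ.+ n ℕ.≤ d
    by-count zero    T? count≡0 = inj₂ (ℕ.≤-reflexive (trans (ℕ.+-identityʳ _)
                                    (#components-empty T? (count≡0⇒∄ T? count≡0))))
    by-count (suc n) {T} T? count≡1+n with ∃-of-count≡suc T? count≡1+n
    ... | e , tₑ with Reach? (T? ∖? e) (src e) (tgt e)
    ...   | yes joined = inj₁ (e , tₑ , joined)
    ...   | no ¬joined with by-count n (T? ∖? e) (count-∖≡ T? tₑ count≡1+n)
    ...     | inj₁ (f , (t_f , _) , f-on-cycle) = inj₁ (f , t_f , Reach-mono (λ ((tₖ , _) , k≢f) → tₖ , k≢f) f-on-cycle)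
    ...     | inj₂ bound = inj₂ (begin
      #components T? ℕ.+ suc n         ≡⟨ ℕ.+-suc (#components T?) n ⟩
      suc (#components T?) ℕ.+ n       ≤⟨ ℕ.+-monoˡ-≤ n (#components-bridge T? tₑ ¬joined) ⟩
      #components (T? ∖? e) ℕ.+ n      ≤⟨ bound ⟩
      d                                ∎)
      where open ℕ.≤-Reasoning

  private
    last-∷ : ∀ {A : Set} (x y : A) ys → List⁺.last (x ∷ y ∷ ys) ≡ List⁺.last (y ∷ ys)
    last-∷ x y ys with List.initLast ys
    ... | []            = refl
    ... | _ List.∷ʳ′ _ = refl

    All-last : ∀ {A : Set} {P : A → Set} {x xs} → All P (x ∷ xs) → P (List⁺.last (x ∷ xs))
    All-last {xs = []}     (px ∷ []) = px
    All-last {P = P} {x} {y ∷ ys} (_ ∷ pys) = subst P (sym (last-∷ x y ys)) (All-last pys)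

    walk-avoiding : ∀ {T f v₀ x xs} → v₀ ∈ₑ S f → All (v₀ ≢_) (x ∷ xs) → Linked (Adj S T) (x ∷ xs) →
                    Reach S (T ∖ f) x (List⁺.last (x ∷ xs))
    walk-avoiding v₀∈f (v₀≢x ∷ []) [-] = ε
    walk-avoiding {T} {f} {x = x} {y ∷ ys} v₀∈f (v₀≢x ∷ v₀∉y∷ys) ((k , tₖ , ends) ∷ y∷ys-linked) =
      subst (Reach S (T ∖ f) x) (sym (last-∷ x y ys))
            ((k , (tₖ , k≢f) , ends) ◅ walk-avoiding v₀∈f v₀∉y∷ys y∷ys-linked)
      where
      k≢f : k ≢ f
      k≢f refl with ∈ₑ-Joins ends v₀∈f
      ... | inj₁ v₀≡x = v₀≢x v₀≡x
      ... | inj₂ v₀≡y = All.head v₀∉y∷ys v₀≡y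

  Reach-Joins : ∀ {T k u v} → Joins k u v → Reach S T u v → Reach S T (src k) (tgt k)
  Reach-Joins (inj₁ refl) p = p
  Reach-Joins (inj₂ refl) p = Reach-sym p

  Cycle⇒CycleEdge : ∀ {T} → Cycle S T → ∃ (CycleEdge T)
  Cycle⇒CycleEdge {T} c = f , t_f , Reach-Joins (proj₂ (proj₂ closing)) (Reach-sym v₀~z)
    where
    open Cycle c
    z : Fin d
    z = List⁺.last (v₂ ∷ rest)
    f : Fin m
    f = proj₁ closing
    t_f : T f
    t_f = proj₁ (proj₂ closing)
    v₀∉v₁… : All (v₀ ≢_) (v₁ ∷ v₂ ∷ rest)
    v₀∉v₁… = AllPairs.head distinct
    v₀v₁ : Adj S T v₀ v₁
    v₀v₁ = Linked.head path
    j : Fin m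
    j = proj₁ v₀v₁
    j≢f : j ≢ f
    j≢f refl with ∈ₑ-Joins (proj₂ (proj₂ closing)) (proj₂ (Joins-∈ₑ (proj₂ (proj₂ v₀v₁))))
    ... | inj₁ v₁≡z  = All-last (AllPairs.head (AllPairs.tail distinct)) v₁≡z
    ... | inj₂ v₁≡v₀ = All.head v₀∉v₁… (sym v₁≡v₀)
    v₀~z : Reach S (T ∖ f) v₀ z
    v₀~z = (j , (proj₁ (proj₂ v₀v₁) , j≢f) , proj₂ (proj₂ v₀v₁))
         ◅ subst (Reach S (T ∖ f) v₁) (last-∷ v₁ v₂ rest)
                 (walk-avoiding (proj₂ (Joins-∈ₑ (proj₂ (proj₂ closing)))) v₀∉v₁… (Linked.tail path))

  InTriple : Fin d → Fin d → Fin d → VertexSet d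
  InTriple a b c u = u ≡ a ⊎ u ≡ b ⊎ u ≡ c

  InTriple? : ∀ a b c → Decidable (InTriple a b c)
  InTriple? a b c u = (u Fin.≟ a) ⊎-dec ((u Fin.≟ b) ⊎-dec (u Fin.≟ c))

  EdgeClosed : VertexSet d → Set
  EdgeClosed X = ∀ l {x u} → X x → Joins l x u → X u

  TriangleAt : Fin m → Fin d → Set
  TriangleAt k w = (∃ λ l → Joins l (src k) w) × (∃ λ l → Joins l (tgt k) w)
                 × EdgeClosed (InTriple (src k) (tgt k) w)

  EdgeClosed-Reach : ∀ {X T x v} → EdgeClosed X → X x → Reach S T x v → X v
  EdgeClosed-Reach closed xₓ ε                  = xₓ
  EdgeClosed-Reach closed xₓ ((l , _ , x-u) ◅ p) = EdgeClosed-Reach closed (closed l xₓ x-u) p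

  Within : VertexSet d → EdgeSet m → Set
  Within C T = ∀ k → T k → ∀ u → u ∈ₑ S k → C u

  Within-Reach : ∀ {C T u v} → Within C T → C u → Reach S T u v → C v
  Within-Reach within cᵤ ε                          = cᵤ
  Within-Reach within cᵤ ((k , tₖ , k-joins) ◅ p) = Within-Reach within (within k tₖ _ (proj₂ (Joins-∈ₑ k-joins))) p

  Within-Root : ∀ {C T u} → Within C T → ¬ C u → Root T u
  Within-Root within ¬cᵤ v ε                          = Fin.≤-refl
  Within-Root within ¬cᵤ v ((k , tₖ , k-joins) ◅ _) = ⊥-elim (¬cᵤ (within k tₖ _ (proj₁ (Joins-∈ₑ k-joins))))

  private
    Roots-in? : ∀ {C : VertexSet d} {T : EdgeSet m} → Decidable C → Decidable T → Decidable (λ u → Root T u × C u)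
    Roots-in? C? T? u = Root? T? u ×-dec C? u

    #components-split : ∀ {C : VertexSet d} {T : EdgeSet m} (C? : Decidable C) (T? : Decidable T) →
                        #components T? ≡ count (Roots-in? C? T?) ℕ.+ count (Roots-in? (λ u → ¬? (C? u)) T?)
    #components-split C? T? = count-split (Root? T?) C?

  suc-#outside≤#components : ∀ {C T} (C? : Decidable C) (T? : Decidable T) → Within C T → ∀ {x} → C x →
                             suc (count (¬? ∘ C?)) ℕ.≤ #components T?
  suc-#outside≤#components {C} {T} C? T? within cₓ with Reach-Root T? _
  ... | r , x~r , root-r = begin
    1 ℕ.+ count (¬? ∘ C?)
      ≤⟨ ℕ.+-mono-≤ root-inside (ℕ.≤-reflexive outside-roots) ⟩
    count (Roots-in? C? T?) ℕ.+ count (Roots-in? (λ u → ¬? (C? u)) T?)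
      ≡⟨ #components-split C? T? ⟨
    #components T? ∎
    where
    open ℕ.≤-Reasoning
    root-inside : 1 ℕ.≤ count (Roots-in? C? T?)
    root-inside = 1≤count (Roots-in? C? T?) (root-r , Within-Reach within cₓ x~r)
    outside-roots : count (¬? ∘ C?) ≡ count (Roots-in? (λ u → ¬? (C? u)) T?)
    outside-roots = count-cong (¬? ∘ C?) (Roots-in? (λ u → ¬? (C? u)) T?) (λ ¬cᵤ → Within-Root within ¬cᵤ , ¬cᵤ) proj₂

  #components≤suc-#outside : ∀ {C T} (C? : Decidable C) (T? : Decidable T) → (∀ u v → C u → C v → Reach S T u v) →
                             #components T? ℕ.≤ suc (count (¬? ∘ C?))
  #components≤suc-#outside {C} {T} C? T? connected = begin
    #components T?                                              ≡⟨ #components-split C? T? ⟩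
    count (Roots-in? C? T?) ℕ.+ count (Roots-in? (λ u → ¬? (C? u)) T?)  ≤⟨ ℕ.+-mono-≤ (count-≤1 (Roots-in? C? T?) one-root-inside)
                                                                              (count-mono (Roots-in? (λ u → ¬? (C? u)) T?) (¬? ∘ C?) proj₂) ⟩
    1 ℕ.+ count (¬? ∘ C?)                                       ∎
    where
    open ℕ.≤-Reasoning
    one-root-inside : ∀ {u v} → Root T u × C u → Root T v × C v → u ≡ v
    one-root-inside (root-u , cᵤ) (root-v , cᵥ) = Root-unique root-u root-v (connected _ _ cᵤ cᵥ)

  allEdges? : Decidable (allEdges {m})
  allEdges? _ = yes tt

  Component? : ∀ r → Decidable (Component S r)
  Component? r = Reach? allEdges? r

  CompEdges? : ∀ r → Decidable (CompEdges S r)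
  CompEdges? r k = Component? r (src k)

  module _ (r : Fin d) where

    private
      C : VertexSet d
      C = Component S r
      F : EdgeSet m
      F = CompEdges S r

    Component-tgt : ∀ {k} → F k → C (tgt k)
    Component-tgt fₖ = fₖ ◅◅ Reach-edge tt

    CompEdges-Within : Within C F
    CompEdges-Within k fₖ u (inj₁ refl) = fₖ
    CompEdges-Within k fₖ u (inj₂ refl) = Component-tgt fₖ

    Reach-CompEdges : ∀ {u v} → C u → Reach S allEdges u v → Reach S F u v
    Reach-CompEdges cᵤ ε                           = ε
    Reach-CompEdges cᵤ ((k , _ , inj₁ refl) ◅ p) = (k , cᵤ , inj₁ refl) ◅ Reach-CompEdges (Component-tgt cᵤ) p
    Reach-CompEdges cᵤ ((k , _ , inj₂ refl) ◅ p) = (k , c-src , inj₂ refl) ◅ Reach-CompEdges c-src p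
      where
      c-src : C (src k)
      c-src = cᵤ ◅◅ Reach-sym (Reach-edge tt)

    CompEdges-connected : ∀ u v → C u → C v → Reach S F u v
    CompEdges-connected u v cᵤ cᵥ = Reach-CompEdges cᵤ (Reach-sym cᵤ ◅◅ cᵥ)

    #outside : ℕ
    #outside = count (¬? ∘ Component? r)

    TreePlusEdge-of-count : count (CompEdges? r) ≡ count (Component? r) → TreePlusEdge S r
    TreePlusEdge-of-count #F≡#C with cycleEdge-or-forest (CompEdges? r)
    ... | inj₂ forest = ⊥-elim (ℕ.1+n≰n (begin
      suc (count (Component? r) ℕ.+ #outside)              ≡⟨ cong suc (ℕ.+-comm (count (Component? r)) #outside) ⟩
      suc #outside ℕ.+ count (Component? r)                ≤⟨ ℕ.+-mono-≤ (suc-#outside≤#components (Component? r) (CompEdges? r) CompEdges-Within ε)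
                                                                         (ℕ.≤-reflexive (sym #F≡#C)) ⟩
      #components (CompEdges? r) ℕ.+ count (CompEdges? r)  ≤⟨ forest ⟩
      d                                                    ≡⟨ count-complement (Component? r) ⟨
      count (Component? r) ℕ.+ #outside                    ∎))
      where open ℕ.≤-Reasoning
    ... | inj₁ (e , fₑ , e-on-cycle) =
      T , e , (T-Within , T-connected , T-acyclic) , (λ (_ , e≢e) → e≢e refl) , (λ k → ⊆-∖-∪ {F}) , T+e⊆F
      where
      T : EdgeSet m
      T = F ∖ e
      T? : Decidable T
      T? = CompEdges? r ∖? e
      T-Within : Within C T
      T-Within k (fₖ , _) = CompEdges-Within k fₖ
      T-connected : ∀ u v → C u → C v → Reach S T u v
      T-connected u v cᵤ cᵥ = Reach-bypass (⊆-∖-∪ {F}) e-on-cycle (CompEdges-connected u v cᵤ cᵥ)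
      T+e⊆F : ∀ k → T k ⊎ k ≡ e → F k
      T+e⊆F k (inj₁ (fₖ , _)) = fₖ
      T+e⊆F k (inj₂ refl)     = fₑ
      T-acyclic : Acyclic S T
      T-acyclic cycle with Cycle⇒CycleEdge cycle
      ... | f , tf , f-on-cycle = ℕ.1+n≰n (begin
        suc (suc (count (T? ∖? f))) ℕ.+ #outside
          ≡⟨ cong (ℕ._+ #outside) #F≡2+#T∖f ⟨
        count (CompEdges? r) ℕ.+ #outside
          ≡⟨ cong (ℕ._+ #outside) #F≡#C ⟩
        count (Component? r) ℕ.+ #outside
          ≡⟨ count-complement (Component? r) ⟩
        d
          ≤⟨ d≤#components+count (T? ∖? f) ⟩
        #components (T? ∖? f) ℕ.+ count (T? ∖? f)
          ≤⟨ ℕ.+-monoˡ-≤ _ (#components≤suc-#outside (Component? r) (T? ∖? f) T∖f-connected) ⟩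
        suc #outside ℕ.+ count (T? ∖? f)
          ≡⟨ cong suc (ℕ.+-comm #outside (count (T? ∖? f))) ⟩
        suc (count (T? ∖? f) ℕ.+ #outside) ∎)
        where
        open ℕ.≤-Reasoning
        T∖f-connected : ∀ u v → C u → C v → Reach S (T ∖ f) u v
        T∖f-connected u v cᵤ cᵥ = Reach-bypass (⊆-∖-∪ {T}) f-on-cycle (T-connected u v cᵤ cᵥ)
        #F≡2+#T∖f : count (CompEdges? r) ≡ suc (suc (count (T? ∖? f)))
        #F≡2+#T∖f = trans (count-remove (CompEdges? r) fₑ) (cong suc (count-remove T? tf))

-- The incidence matrix V_S

module Incidence {d m : ℕ} (S : Fin m → Edge d) where

  open Graph S

  VS-∈ₑ : ∀ {i k} → i ∈ₑ S k → VS S i k ≡ 1ℚ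
  VS-∈ₑ {i} {k} i∈k with i Fin.≟ src k | i Fin.≟ tgt k
  ... | yes _    | _        = refl
  ... | no _     | yes _    = refl
  ... | no i≢src | no i≢tgt = ⊥-elim ([ i≢src , i≢tgt ]′ i∈k)

  VS-∉ₑ : ∀ {i k} → ¬ i ∈ₑ S k → VS S i k ≡ 0ℚ
  VS-∉ₑ {i} {k} i∉k with i Fin.≟ src k | i Fin.≟ tgt k
  ... | yes i≡src | _         = ⊥-elim (i∉k (inj₁ i≡src))
  ... | no _      | yes i≡tgt = ⊥-elim (i∉k (inj₂ i≡tgt))
  ... | no _      | no _      = refl

  VS-column : ∀ i k → VS S i k ≡ identity i (src k) + identity i (tgt k)
  VS-column i k with i ∈ₑ? k
  ... | yes (inj₁ refl) = trans (VS-∈ₑ (src∈ₑ k)) (sym (cong₂ _+_ (identity-diag i) (identity-≢ (src≢tgt k))))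
  ... | yes (inj₂ refl) = trans (VS-∈ₑ (tgt∈ₑ k)) (sym (cong₂ _+_ (identity-≢ (src≢tgt k ∘ sym)) (identity-diag i)))
  ... | no i∉k          = trans (VS-∉ₑ i∉k) (sym (cong₂ _+_ (identity-≢ (i∉k ∘ inj₁)) (identity-≢ (i∉k ∘ inj₂))))

  sumℚ-*-VS : ∀ (f : Fin d → ℚ) k → sumℚ (λ i → f i * VS S i k) ≡ f (src k) + f (tgt k)
  sumℚ-*-VS f k = begin
    sumℚ (λ i → f i * VS S i k)
      ≡⟨ sumℚ-cong (λ i → cong (f i *_) (VS-column i k)) ⟩
    sumℚ (λ i → f i * (identity i (src k) + identity i (tgt k)))
      ≡⟨ sumℚ-cong (λ i → ℚ.*-distribˡ-+ (f i) _ _) ⟩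
    sumℚ (λ i → f i * identity i (src k) + f i * identity i (tgt k))
      ≡⟨ sumℚ-+ (λ i → f i * identity i (src k)) (λ i → f i * identity i (tgt k)) ⟩
    sumℚ (λ i → f i * identity i (src k)) + sumℚ (λ i → f i * identity i (tgt k))
      ≡⟨ cong₂ _+_ (sumℚ-*-identity f (src k)) (sumℚ-*-identity f (tgt k)) ⟩
    f (src k) + f (tgt k) ∎
    where open ≡-Reasoning

  sumℚ-VS-*-leaf : ∀ (g : Fin m → ℚ) {i k} → i ∈ₑ S k → (∀ l → i ∈ₑ S l → l ≡ k) →
                   sumℚ (λ l → VS S i l * g l) ≡ g k
  sumℚ-VS-*-leaf g {i} {k} i∈k only-k = trans (sumℚ-cong VS-g≡g-identity) (sumℚ-*-identity g k)
    where
    VS-g≡g-identity : ∀ l → VS S i l * g l ≡ g l * identity l k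
    VS-g≡g-identity l with i ∈ₑ? l
    ... | yes i∈l = begin
      VS S i l * g l
        ≡⟨ cong (_* g l) (VS-∈ₑ i∈l) ⟩
      1ℚ * g l
        ≡⟨ ℚ.*-comm 1ℚ (g l) ⟩
      g l * 1ℚ
        ≡⟨ cong (g l *_) (trans (sym (identity-diag k)) (cong (λ l′ → identity l′ k) (sym (only-k l i∈l)))) ⟩
      g l * identity l k ∎
      where open ≡-Reasoning
    ... | no i∉l = begin
      VS S i l * g l      ≡⟨ cong (_* g l) (VS-∉ₑ i∉l) ⟩
      0ℚ * g l            ≡⟨ ℚ.*-zeroˡ (g l) ⟩
      0ℚ                  ≡⟨ ℚ.*-zeroʳ (g l) ⟨
      g l * 0ℚ            ≡⟨ cong (g l *_) (identity-≢ {i = l} {k} (λ { refl → i∉l i∈k })) ⟨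
      g l * identity l k  ∎
      where open ≡-Reasoning

  VS-≡0-or-Component⇔CompEdges : ∀ r i k → VS S i k ≡ 0ℚ ⊎ (Component S r i ⇔ CompEdges S r k)
  VS-≡0-or-Component⇔CompEdges r i k with i ∈ₑ? k
  ... | yes (inj₁ refl) = inj₂ (mk⇔ (λ r~i → r~i) (λ r~i → r~i))
  ... | yes (inj₂ refl) = inj₂ (mk⇔ (λ r~tgt → r~tgt ◅◅ Reach-sym (Reach-edge tt)) (Component-tgt r))
  ... | no i∉k          = inj₁ (VS-∉ₑ i∉k)

#CompEdges≡#Component : ∀ {d} (S : Fin d → Edge d) {W : Mat d d} → VS S ⊗ W ≋ identity → W ⊗ VS S ≋ identity →
                        ∀ r → count (Graph.CompEdges? S r) ≡ count (Graph.Component? S r)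
#CompEdges≡#Component S VW≋I WV≋I r =
  sym (count-≡-of-inverse VW≋I WV≋I (Graph.Component? S r) (Graph.CompEdges? S r) (Incidence.VS-≡0-or-Component⇔CompEdges S r))

-- The rows of W = V_S⁻¹

module Rows {d : ℕ} (S : Fin d → Edge d) (S-injective : ∀ k l → ends (S k) ≡ ends (S l) → k ≡ l)
            {W : Mat d d} (VW≋I : VS S ⊗ W ≋ identity) (WV≋I : W ⊗ VS S ≋ identity) where

  open Graph S
  open Incidence S

  row-Joins : ∀ k {l x w} → Joins l x w → W k x + W k w ≡ identity k l
  row-Joins k {l} (inj₁ refl) = trans (sym (sumℚ-*-VS (W k) l)) (WV≋I k l)
  row-Joins k {l} (inj₂ refl) = trans (ℚ.+-comm (W k (tgt l)) (W k (src l))) (row-Joins k (inj₁ refl))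

  row-flip : ∀ {k l x w} → k ≢ l → Joins l x w → W k w ≡ - W k x
  row-flip {k} {l} {x} {w} k≢l x-w = begin
    W k w                        ≡⟨ solve 2 (λ a b → b := (a :+ b) :- a) refl (W k x) (W k w) ⟩
    (W k x + W k w) - W k x      ≡⟨ cong (_- W k x) (trans (row-Joins k x-w) (identity-≢ k≢l)) ⟩
    0ℚ - W k x                   ≡⟨ ℚ.+-identityˡ (- W k x) ⟩
    - W k x                      ∎
    where open ≡-Reasoning

  row-leaf : ∀ {i k} → i ∈ₑ S k → (∀ l → i ∈ₑ S l → l ≡ k) → W k i ≡ 1ℚ
  row-leaf {i} i∈k only-k =
    trans (sym (sumℚ-VS-*-leaf (λ l → W l i) i∈k only-k)) (trans (VW≋I i i) (identity-diag i))

  RowSq : Fin d → ℚ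
  RowSq k = sumℚ (λ i → W k i ²)

  sumList≤RowSq : ∀ k {xs} → Unique xs → sumList (map (λ i → W k i ²) xs) ≤ RowSq k
  sumList≤RowSq k = sumList≤sumℚ (λ i → ²-nonNeg (W k i))

  sumList-row²-const : ∀ k {xs c} → All (λ x → W k x ² ≡ c) xs →
                       sumList (map (λ i → W k i ²) xs) ≡ sumList (map (const c) xs)
  sumList-row²-const k = cong sumList ∘ List.map-cong-local

  ¼ ¾ : ℚ
  ¼ = + 1 / 4
  ¾ = + 3 / 4

  RowBound : Fin d → Set
  RowBound k = ¾ ≤ RowSq k × (1ℚ ≤ RowSq k ⊎ ∃ (TriangleAt k))

  ¾≤1 : ¾ ≤ 1ℚ
  ¾≤1 = toWitness {a? = ¾ ℚ.≤? 1ℚ} tt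

  1≤RowSq⇒RowBound : ∀ {k} → 1ℚ ≤ RowSq k → RowBound k
  1≤RowSq⇒RowBound 1≤R = ℚ.≤-trans ¾≤1 1≤R , inj₁ 1≤R

  leaf-RowBound : ∀ {k x} → x ∈ₑ S k → (∀ l → x ∈ₑ S l → l ≡ k) → RowBound k
  leaf-RowBound {k} {x} x∈k only-k = 1≤RowSq⇒RowBound (begin
    1ℚ              ≡⟨⟩
    1ℚ ² + 0ℚ       ≡⟨ cong (λ v → v ² + 0ℚ) (row-leaf x∈k only-k) ⟨
    W k x ² + 0ℚ    ≤⟨ sumList≤RowSq k ([] ∷ []) ⟩
    RowSq k         ∎)
    where open ℚ.≤-Reasoning

  four-point-bound : ∀ k {w z} → Unique (src k ∷ tgt k ∷ w ∷ z ∷ []) →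
                     W k w ≡ - W k (src k) → W k z ≡ - W k (tgt k) → 1ℚ ≤ RowSq k
  four-point-bound k {w} {z} distinct Ww≡-Wa Wz≡-Wb = begin
    1ℚ                                                 ≤⟨ 1≤sum-of-squares (W k a) (W k b) a+b≡1 ⟩
    W k a ² + (W k b ² + ((- W k a) ² + ((- W k b) ² + 0ℚ)))
      ≡⟨ cong₂ (λ p q → W k a ² + (W k b ² + (p ² + (q ² + 0ℚ)))) Ww≡-Wa Wz≡-Wb ⟨
    sumList (map (λ i → W k i ²) (a ∷ b ∷ w ∷ z ∷ []))  ≤⟨ sumList≤RowSq k distinct ⟩
    RowSq k                                            ∎
    where
    open ℚ.≤-Reasoning
    a b : Fin d
    a = src k
    b = tgt k
    a+b≡1 : W k a + W k b ≡ 1ℚ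
    a+b≡1 = trans (row-Joins k (inj₁ refl)) (identity-diag k)

  triangle-RowBound : ∀ k {w l₁ l₂} → Joins l₁ (src k) w → Joins l₂ (tgt k) w →
                      W k w ≡ - W k (src k) → W k w ≡ - W k (tgt k) → RowBound k
  triangle-RowBound k {w} a-w b-w Ww≡-Wa Ww≡-Wb = ¾≤RowSq , leaves-or-closed
    where
    open ℚ.≤-Reasoning
    a b : Fin d
    a = src k
    b = tgt k
    X : VertexSet d
    X = InTriple a b w
    Wa≡Wb : W k a ≡ W k b
    Wa≡Wb = ℚ.neg-injective (trans (sym Ww≡-Wa) Ww≡-Wb)
    Wa≡½ : W k a ≡ ½
    Wa≡½ = half-of-1 (trans (row-Joins k (inj₁ refl)) (identity-diag k)) Wa≡Wb
    Wb≡½ : W k b ≡ ½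
    Wb≡½ = trans (sym Wa≡Wb) Wa≡½
    Ww≡-½ : W k w ≡ -½
    Ww≡-½ = trans Ww≡-Wa (cong -_ Wa≡½)
    sq-on-X : ∀ {x} → X x → W k x ² ≡ ½ ²
    sq-on-X (inj₁ refl)        = cong _² Wa≡½
    sq-on-X (inj₂ (inj₁ refl)) = cong _² Wb≡½
    sq-on-X (inj₂ (inj₂ refl)) = trans (cong _² Ww≡-½) (neg-² ½)
    sq-on-abw : All (λ x → W k x ² ≡ ½ ²) (a ∷ b ∷ w ∷ [])
    sq-on-abw = sq-on-X (inj₁ refl) ∷ sq-on-X (inj₂ (inj₁ refl)) ∷ sq-on-X (inj₂ (inj₂ refl)) ∷ []
    a≢b : a ≢ b
    a≢b = src≢tgt k
    a≢w : a ≢ w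
    a≢w = Joins-≢ a-w
    b≢w : b ≢ w
    b≢w = Joins-≢ b-w
    ¾≤RowSq : ¾ ≤ RowSq k
    ¾≤RowSq = begin
      ¾                                               ≡⟨⟩
      sumList (map (const (½ ²)) (a ∷ b ∷ w ∷ []))    ≡⟨ sumList-row²-const k sq-on-abw ⟨
      sumList (map (λ i → W k i ²) (a ∷ b ∷ w ∷ []))  ≤⟨ sumList≤RowSq k ((a≢b ∷ a≢w ∷ []) ∷ (b≢w ∷ []) ∷ [] ∷ []) ⟩
      RowSq k                                         ∎
    Leaves : Fin d → Set
    Leaves l = ∃ λ x → ∃ λ u → X x × Joins l x u × ¬ X u
    1≤RowSq-of-Leaves : ∀ {l} → Leaves l → 1ℚ ≤ RowSq k
    1≤RowSq-of-Leaves {l} (x , u , x∈X , x-u , u∉X) = begin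
      1ℚ                                                  ≡⟨⟩
      sumList (map (const (½ ²)) (a ∷ b ∷ w ∷ u ∷ []))    ≡⟨ sumList-row²-const k (sq-on-X (inj₁ refl) ∷ sq-on-X (inj₂ (inj₁ refl)) ∷ sq-on-X (inj₂ (inj₂ refl)) ∷ sq-u ∷ []) ⟨
      sumList (map (λ i → W k i ²) (a ∷ b ∷ w ∷ u ∷ []))  ≤⟨ sumList≤RowSq k distinct ⟩
      RowSq k                                             ∎
      where
      distinct : Unique (a ∷ b ∷ w ∷ u ∷ [])
      distinct = (a≢b ∷ a≢w ∷ (u∉X ∘ inj₁ ∘ sym) ∷ [])
               ∷ (b≢w ∷ (u∉X ∘ inj₂ ∘ inj₁ ∘ sym) ∷ [])
               ∷ ((u∉X ∘ inj₂ ∘ inj₂ ∘ sym) ∷ [])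
               ∷ []
               ∷ []
      k≢l : k ≢ l
      k≢l refl = u∉X ([ (λ u≡a → inj₁ u≡a) , (λ u≡b → inj₂ (inj₁ u≡b)) ]′ (proj₂ (Joins-∈ₑ x-u)))
      sq-u : W k u ² ≡ ½ ²
      sq-u = trans (cong _² (row-flip k≢l x-u)) (trans (neg-² (W k x)) (sq-on-X x∈X))
    leaves-or-closed : 1ℚ ≤ RowSq k ⊎ ∃ (TriangleAt k)
    leaves-or-closed with Fin.any? (λ l → leaves? l (src l) (tgt l) ⊎-dec leaves? l (tgt l) (src l))
      where
      leaves? : ∀ l x u → Dec (X x × ¬ X u)
      leaves? l x u = InTriple? a b w x ×-dec ¬? (InTriple? a b w u)
    ... | yes (l , inj₁ (x∈X , u∉X)) = inj₁ (1≤RowSq-of-Leaves (_ , _ , x∈X , inj₁ refl , u∉X))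
    ... | yes (l , inj₂ (x∈X , u∉X)) = inj₁ (1≤RowSq-of-Leaves (_ , _ , x∈X , inj₂ refl , u∉X))
    ... | no ∄leaving = inj₂ (w , (_ , a-w) , (_ , b-w) , closed)
      where
      closed : EdgeClosed X
      closed l {x} {u} x∈X x-u with InTriple? a b w u
      ... | yes u∈X = u∈X
      ... | no u∉X with x-u
      ...   | inj₁ refl = ⊥-elim (∄leaving (l , inj₁ (x∈X , u∉X)))
      ...   | inj₂ refl = ⊥-elim (∄leaving (l , inj₂ (x∈X , u∉X)))

  private
    other-edge-at : ∀ k x → (∀ l → x ∈ₑ S l → l ≡ k) ⊎ ∃ λ l → l ≢ k × x ∈ₑ S l
    other-edge-at k x with Fin.any? (λ l → ¬? (l Fin.≟ k) ×-dec x ∈ₑ? l)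
    ... | yes other = inj₂ other
    ... | no ∄other = inj₁ only-k
      where
      only-k : ∀ l → x ∈ₑ S l → l ≡ k
      only-k l x∈l with l Fin.≟ k
      ... | yes l≡k = l≡k
      ... | no l≢k  = ⊥-elim (∄other (l , l≢k , x∈l))

  two-neighbours-RowBound : ∀ k {l₁ l₂ w z} → l₁ ≢ k → l₂ ≢ k → Joins l₁ (src k) w → Joins l₂ (tgt k) z →
                            W k w ≡ - W k (src k) → W k z ≡ - W k (tgt k) → RowBound k
  two-neighbours-RowBound k {w = w} {z} l₁≢k l₂≢k a-w b-z Ww≡-Wa Wz≡-Wb with w Fin.≟ z
  ... | yes refl = triangle-RowBound k a-w b-z Ww≡-Wa Wz≡-Wb
  ... | no w≢z   = 1≤RowSq⇒RowBound (four-point-bound k distinct Ww≡-Wa Wz≡-Wb)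
    where
    k-Joins : Joins k (src k) (tgt k)
    k-Joins = inj₁ refl
    distinct : Unique (src k ∷ tgt k ∷ w ∷ z ∷ [])
    distinct = (src≢tgt k ∷ Joins-≢ a-w ∷ (λ { refl → l₂≢k (Joins-unique S-injective (Joins-sym b-z) k-Joins) }) ∷ [])
             ∷ ((λ { refl → l₁≢k (Joins-unique S-injective a-w k-Joins) }) ∷ Joins-≢ b-z ∷ [])
             ∷ (w≢z ∷ [])
             ∷ []
             ∷ []

  row-bound : ∀ k → RowBound k
  row-bound k with other-edge-at k (src k) | other-edge-at k (tgt k)
  ... | inj₁ only-k | _           = leaf-RowBound (src∈ₑ k) only-k
  ... | inj₂ _      | inj₁ only-k = leaf-RowBound (tgt∈ₑ k) only-k
  ... | inj₂ (l₁ , l₁≢k , a∈l₁) | inj₂ (l₂ , l₂≢k , b∈l₂) with other-end a∈l₁ | other-end b∈l₂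
  ...   | w , a-w | z , b-z =
    two-neighbours-RowBound k l₁≢k l₂≢k a-w b-z (row-flip (l₁≢k ∘ sym) a-w) (row-flip (l₂≢k ∘ sym) b-z)

  corner-value : ∀ k {v u u′ e₁ e₂ e₃ x y z} → Joins e₁ v u → Joins e₂ v u′ → Joins e₃ u u′ →
                 identity k e₁ ≡ x → identity k e₂ ≡ y → identity k e₃ ≡ z → W k v ≡ (x + y - z) * ½
  corner-value k {v} {u} {u′} {e₁} {e₂} {e₃} v-u v-u′ u-u′ refl refl refl = begin
    W k v
      ≡⟨ solve 3 (λ p q r → p := ((p :+ q) :+ (p :+ r) :- (q :+ r)) :* con ½) refl (W k v) (W k u) (W k u′) ⟩
    ((W k v + W k u) + (W k v + W k u′) - (W k u + W k u′)) * ½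
      ≡⟨ cong₂ (λ p q → (p + q - (W k u + W k u′)) * ½) (row-Joins k v-u) (row-Joins k v-u′) ⟩
    (identity k e₁ + identity k e₂ - (W k u + W k u′)) * ½
      ≡⟨ cong (λ r → (identity k e₁ + identity k e₂ - r) * ½) (row-Joins k u-u′) ⟩
    (identity k e₁ + identity k e₂ - identity k e₃) * ½ ∎
    where open ≡-Reasoning

  corner-sq : ∀ k {v u u′ e₁ e₂ e₃} → Joins e₁ v u → Joins e₂ v u′ → Joins e₃ u u′ →
              W k v ² ≡ indicator ((k Fin.≟ e₁) ⊎-dec ((k Fin.≟ e₂) ⊎-dec (k Fin.≟ e₃))) * ¼
  corner-sq k {e₁ = e₁} {e₂} {e₃} v-u v-u′ u-u′ with k Fin.≟ e₁ | k Fin.≟ e₂ | k Fin.≟ e₃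
  ... | yes refl | yes refl | _        = ⊥-elim (Joins-≢ u-u′ (Joins-other-end v-u v-u′))
  ... | yes refl | no _     | yes refl = ⊥-elim (Joins-≢ v-u′ (Joins-other-end (Joins-sym v-u) u-u′))
  ... | no _     | yes refl | yes refl = ⊥-elim (Joins-≢ v-u (Joins-other-end (Joins-sym v-u′) (Joins-sym u-u′)))
  ... | yes refl | no k≢e₂  | no k≢e₃  =
    cong _² (corner-value k v-u v-u′ u-u′ (identity-diag k) (identity-≢ k≢e₂) (identity-≢ k≢e₃))
  ... | no k≢e₁  | yes refl | no k≢e₃  =
    cong _² (corner-value k v-u v-u′ u-u′ (identity-≢ k≢e₁) (identity-diag k) (identity-≢ k≢e₃))
  ... | no k≢e₁  | no k≢e₂  | yes refl =
    cong _² (corner-value k v-u v-u′ u-u′ (identity-≢ k≢e₁) (identity-≢ k≢e₂) (identity-diag k))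
  ... | no k≢e₁  | no k≢e₂  | no k≢e₃  =
    cong _² (corner-value k v-u v-u′ u-u′ (identity-≢ k≢e₁) (identity-≢ k≢e₂) (identity-≢ k≢e₃))

-- Triangle components of H

module Triangles {d m : ℕ} (S : Fin m → Edge d) (S-injective : ∀ k l → ends (S k) ≡ ends (S l) → k ≡ l) where

  open Graph S

  record Triangle (r : Fin d) : Set where
    field
      a b c    : Fin d
      ab bc ac : Fin m
      ab-Joins : Joins ab a b
      bc-Joins : Joins bc b c
      ac-Joins : Joins ac a c
      members  : ∀ u → Component S r u ⇔ InTriple a b c u

    InEdges : Fin m → Set
    InEdges k = k ≡ ab ⊎ k ≡ bc ⊎ k ≡ ac

    InEdges? : Decidable InEdges
    InEdges? k = (k Fin.≟ ab) ⊎-dec ((k Fin.≟ bc) ⊎-dec (k Fin.≟ ac))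

    Joins-inside : ∀ {k x u} → Joins k x u → InTriple a b c x → InTriple a b c u → InEdges k
    Joins-inside k-x-u (inj₁ refl)        (inj₁ refl)        = ⊥-elim (Joins-≢ k-x-u refl)
    Joins-inside k-x-u (inj₁ refl)        (inj₂ (inj₁ refl)) = inj₁ (Joins-unique S-injective k-x-u ab-Joins)
    Joins-inside k-x-u (inj₁ refl)        (inj₂ (inj₂ refl)) = inj₂ (inj₂ (Joins-unique S-injective k-x-u ac-Joins))
    Joins-inside k-x-u (inj₂ (inj₁ refl)) (inj₁ refl)        = inj₁ (Joins-unique S-injective (Joins-sym k-x-u) ab-Joins)
    Joins-inside k-x-u (inj₂ (inj₁ refl)) (inj₂ (inj₁ refl)) = ⊥-elim (Joins-≢ k-x-u refl)
    Joins-inside k-x-u (inj₂ (inj₁ refl)) (inj₂ (inj₂ refl)) = inj₂ (inj₁ (Joins-unique S-injective k-x-u bc-Joins))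
    Joins-inside k-x-u (inj₂ (inj₂ refl)) (inj₁ refl)        = inj₂ (inj₂ (Joins-unique S-injective (Joins-sym k-x-u) ac-Joins))
    Joins-inside k-x-u (inj₂ (inj₂ refl)) (inj₂ (inj₁ refl)) = inj₂ (inj₁ (Joins-unique S-injective (Joins-sym k-x-u) bc-Joins))
    Joins-inside k-x-u (inj₂ (inj₂ refl)) (inj₂ (inj₂ refl)) = ⊥-elim (Joins-≢ k-x-u refl)

    InEdges⇔Component-src : ∀ k → InEdges k ⇔ Component S r (src k)
    InEdges⇔Component-src k = mk⇔ (Equivalence.from (members (src k)) ∘ src-inside) from
      where
      ends-inside : ∀ {l x u} → Joins l x u → InTriple a b c x → InTriple a b c u → ∀ {v} → v ∈ₑ S l → InTriple a b c v
      ends-inside l-x-u x∈ u∈ v∈l = [ (λ { refl → x∈ }) , (λ { refl → u∈ }) ]′ (∈ₑ-Joins l-x-u v∈l)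
      src-inside : InEdges k → InTriple a b c (src k)
      src-inside (inj₁ refl)        = ends-inside ab-Joins (inj₁ refl) (inj₂ (inj₁ refl)) (src∈ₑ k)
      src-inside (inj₂ (inj₁ refl)) = ends-inside bc-Joins (inj₂ (inj₁ refl)) (inj₂ (inj₂ refl)) (src∈ₑ k)
      src-inside (inj₂ (inj₂ refl)) = ends-inside ac-Joins (inj₁ refl) (inj₂ (inj₂ refl)) (src∈ₑ k)
      from : Component S r (src k) → InEdges k
      from r~src = Joins-inside (inj₁ refl) (Equivalence.to (members (src k)) r~src)
                                            (Equivalence.to (members (tgt k)) (r~src ◅◅ Reach-edge tt))

  IsTriangleComp⇒Triangle : ∀ {r} → IsTriangleComp S r → Triangle r
  IsTriangleComp⇒Triangle (a , b , c , _ , _ , _ , members , (ab , _ , ab-Joins) , (bc , _ , bc-Joins) , (ac , _ , ac-Joins)) =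
    record { a = a ; b = b ; c = c ; ab = ab ; bc = bc ; ac = ac
           ; ab-Joins = ab-Joins ; bc-Joins = bc-Joins ; ac-Joins = ac-Joins ; members = members }

  TriangleAt⇒IsTriangleComp : ∀ {k w} → TriangleAt k w →
                              ∃ λ r → Component S r (src k) × IsRoot S r × IsTriangleComp S r
  TriangleAt⇒IsTriangleComp {k} {w} ((l₁ , a-w) , (l₂ , b-w) , closed) with Reach-Root allEdges? (src k)
  ... | r , a~r , root-r =
    r , Reach-sym a~r , root-r ,
    (src k , tgt k , w , src≢tgt k , Joins-≢ b-w , Joins-≢ a-w , members , (k , tt , inj₁ refl) , (l₂ , tt , b-w) , (l₁ , tt , a-w))
    where
    X : VertexSet d
    X = InTriple (src k) (tgt k) w
    members : ∀ u → Component S r u ⇔ X u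
    members u = mk⇔ (EdgeClosed-Reach closed (EdgeClosed-Reach closed (inj₁ refl) a~r)) from
      where
      from : X u → Component S r u
      from (inj₁ refl)        = Reach-sym a~r
      from (inj₂ (inj₁ refl)) = Reach-sym a~r ◅◅ Reach-edge tt
      from (inj₂ (inj₂ refl)) = Reach-sym a~r ◅◅ ((l₁ , tt , a-w) ◅ ε)

-- The trace of (V_S V_Sᵀ)⁻¹

module Trace {d : ℕ} (S : Fin d → Edge d) (S-injective : ∀ k l → ends (S k) ≡ ends (S l) → k ≡ l)
             {W : Mat d d} (VW≋I : VS S ⊗ W ≋ identity) (WV≋I : W ⊗ VS S ≋ identity)
             {t : ℕ} (f : Fin t → Fin d) (f-injective : ∀ i j → f i ≡ f j → i ≡ j)
             (triangle-roots : ∀ r → (IsRoot S r × IsTriangleComp S r) ⇔ (∃ λ i → f i ≡ r)) where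

  open Graph S
  open Rows S S-injective VW≋I WV≋I
  open Triangles S S-injective

  trace≡sumℚ-RowSq : ∀ {W′} → IsInverse (VS S ⊗ transpose (VS S)) W′ → trace W′ ≡ sumℚ RowSq
  trace≡sumℚ-RowSq inv = trans (trace-cong (gram-inverse {V = VS S} {W} VW≋I WV≋I inv)) (trace-transpose-⊗-self W)

  triangle : ∀ i → IsRoot S (f i) × Triangle (f i)
  triangle i with Equivalence.from (triangle-roots (f i)) (i , refl)
  ... | root , is-triangle = root , IsTriangleComp⇒Triangle is-triangle

  tri : ∀ i → Triangle (f i)
  tri i = proj₂ (triangle i)

  InTriangle : Fin d → Set
  InTriangle k = ∃ λ i → Triangle.InEdges (tri i) k

  InTriangle? : Decidable InTriangle
  InTriangle? k = Fin.any? (λ i → Triangle.InEdges? (tri i) k)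

  TriangleAt⇒InTriangle : ∀ {k w} → TriangleAt k w → InTriangle k
  TriangleAt⇒InTriangle {k} triangle-at with TriangleAt⇒IsTriangleComp triangle-at
  ... | r , r~src , root , is-triangle with Equivalence.to (triangle-roots r) (root , is-triangle)
  ...   | i , refl = i , Equivalence.from (Triangle.InEdges⇔Component-src (tri i) k) r~src

  triangle-edge : Fin t → Fin 3 → Fin d
  triangle-edge i zero             = Triangle.ab (tri i)
  triangle-edge i (suc zero)       = Triangle.bc (tri i)
  triangle-edge i (suc (suc zero)) = Triangle.ac (tri i)

  #InTriangle≤3t : count InTriangle? ℕ.≤ 3 ℕ.* t
  #InTriangle≤3t = subst (count InTriangle? ℕ.≤_) (ℕ.*-comm t 3) (count-≤-image InTriangle? edge covered)
    where
    edge : Fin (t ℕ.* 3) → Fin d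
    edge = uncurry triangle-edge ∘ Fin.remQuot 3
    covered-at : ∀ i p → ∃ λ x → edge x ≡ triangle-edge i p
    covered-at i p = Fin.combine i p , cong (uncurry triangle-edge) (Fin.remQuot-combine i p)
    covered : ∀ {k} → InTriangle k → ∃ λ x → edge x ≡ k
    covered (i , inj₁ refl)        = covered-at i zero
    covered (i , inj₂ (inj₁ refl)) = covered-at i (suc zero)
    covered (i , inj₂ (inj₂ refl)) = covered-at i (suc (suc zero))

  RowSq-lower : ∀ k → 1ℚ + indicator (InTriangle? k) * (- ¼) ≤ RowSq k
  RowSq-lower k with InTriangle? k | row-bound k
  ... | yes _   | ¾≤R , _            = ¾≤R
  ... | no _    | _ , inj₁ 1≤R       = 1≤R
  ... | no ¬tri | _ , inj₂ (_ , at) = ⊥-elim (¬tri (TriangleAt⇒InTriangle at))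

  sumℚ-RowSq-lower : sumℚ (λ k → 1ℚ + indicator (InTriangle? k) * (- ¼)) ≡ fromℕ d - fromℕ (count InTriangle?) * ¼
  sumℚ-RowSq-lower = begin
    sumℚ (λ k → 1ℚ + indicator (InTriangle? k) * (- ¼))
      ≡⟨ sumℚ-+ (const 1ℚ) (λ k → indicator (InTriangle? k) * (- ¼)) ⟩
    sumℚ {d} (const 1ℚ) + sumℚ (λ k → indicator (InTriangle? k) * (- ¼))
      ≡⟨ cong₂ _+_ (sumℚ-const d 1ℚ) (sumℚ-*ʳ (- ¼) (indicator ∘ InTriangle?)) ⟩
    fromℕ d * 1ℚ + sumℚ (indicator ∘ InTriangle?) * (- ¼)
      ≡⟨ cong (λ s → fromℕ d * 1ℚ + s * (- ¼)) (sumℚ-indicator InTriangle?) ⟩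
    fromℕ d * 1ℚ + fromℕ (count InTriangle?) * (- ¼)
      ≡⟨ solve 3 (λ x y q → x :* con 1ℚ :+ y :* (:- q) := x :- y :* q) refl (fromℕ d) (fromℕ (count InTriangle?)) ¼ ⟩
    fromℕ d - fromℕ (count InTriangle?) * ¼ ∎
    where open ≡-Reasoning

  trace-lower : ∀ {W′} → IsInverse (VS S ⊗ transpose (VS S)) W′ → (+ d) / 1 - (+ (3 ℕ.* t)) / 4 ≤ trace W′
  trace-lower {W′} inv = begin
    fromℕ d - (+ (3 ℕ.* t)) / 4
      ≡⟨ cong (λ q → fromℕ d - q) (/-as-* (3 ℕ.* t) 3) ⟩
    fromℕ d - fromℕ (3 ℕ.* t) * ¼
      ≤⟨ ℚ.+-monoʳ-≤ (fromℕ d) (ℚ.neg-antimono-≤ (ℚ.*-monoʳ-≤-nonNeg ¼ (fromℕ-mono-≤ #InTriangle≤3t))) ⟩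
    fromℕ d - fromℕ (count InTriangle?) * ¼
      ≡⟨ sumℚ-RowSq-lower ⟨
    sumℚ (λ k → 1ℚ + indicator (InTriangle? k) * (- ¼))
      ≤⟨ sumℚ-mono-≤ RowSq-lower ⟩
    sumℚ RowSq
      ≡⟨ trace≡sumℚ-RowSq inv ⟨
    trace W′ ∎
    where open ℚ.≤-Reasoning

  same-triangle : ∀ {i i′ v} → Component S (f i) v → Component S (f i′) v → i ≡ i′
  same-triangle {i} {i′} fi~v fi′~v =
    f-injective i i′ (Root-unique (proj₁ (triangle i)) (proj₁ (triangle i′)) (fi~v ◅◅ Reach-sym fi′~v))

  triangle-sq : ∀ i k {v} → InTriple (Triangle.a (tri i)) (Triangle.b (tri i)) (Triangle.c (tri i)) v →
                W k v ² ≡ indicator (Triangle.InEdges? (tri i) k) * ¼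
  triangle-sq i k (inj₁ refl) = trans (corner-sq k ab-Joins ac-Joins bc-Joins)
    (cong (_* ¼) (indicator-cong ((k Fin.≟ ab) ⊎-dec ((k Fin.≟ ac) ⊎-dec (k Fin.≟ bc))) (InEdges? k)
                                 (mk⇔ [ inj₁ , [ inj₂ ∘ inj₂ , inj₂ ∘ inj₁ ]′ ]′ [ inj₁ , [ inj₂ ∘ inj₂ , inj₂ ∘ inj₁ ]′ ]′)))
    where open Triangle (tri i)
  triangle-sq i k (inj₂ (inj₁ refl)) = corner-sq k (Joins-sym ab-Joins) bc-Joins ac-Joins
    where open Triangle (tri i)
  triangle-sq i k (inj₂ (inj₂ refl)) = trans (corner-sq k (Joins-sym ac-Joins) (Joins-sym bc-Joins) ab-Joins)
    (cong (_* ¼) (indicator-cong ((k Fin.≟ ac) ⊎-dec ((k Fin.≟ bc) ⊎-dec (k Fin.≟ ab))) (InEdges? k)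
                                 (mk⇔ [ inj₂ ∘ inj₂ , [ inj₂ ∘ inj₁ , inj₁ ]′ ]′ [ inj₂ ∘ inj₂ , [ inj₂ ∘ inj₁ , inj₁ ]′ ]′)))
    where open Triangle (tri i)

  module AllTriangles (3t≡d : 3 ℕ.* t ≡ d) where

    corner : Fin t → Fin 3 → Fin d
    corner i zero             = Triangle.a (tri i)
    corner i (suc zero)       = Triangle.b (tri i)
    corner i (suc (suc zero)) = Triangle.c (tri i)

    corner-inside : ∀ i p → Component S (f i) (corner i p)
    corner-inside i zero             = Equivalence.from (Triangle.members (tri i) _) (inj₁ refl)
    corner-inside i (suc zero)       = Equivalence.from (Triangle.members (tri i) _) (inj₂ (inj₁ refl))
    corner-inside i (suc (suc zero)) = Equivalence.from (Triangle.members (tri i) _) (inj₂ (inj₂ refl))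

    corner-injectiveʳ : ∀ i {p q} → corner i p ≡ corner i q → p ≡ q
    corner-injectiveʳ i {zero}             {zero}             _  = refl
    corner-injectiveʳ i {zero}             {suc zero}         eq = ⊥-elim (Joins-≢ (Triangle.ab-Joins (tri i)) eq)
    corner-injectiveʳ i {zero}             {suc (suc zero)}   eq = ⊥-elim (Joins-≢ (Triangle.ac-Joins (tri i)) eq)
    corner-injectiveʳ i {suc zero}         {zero}             eq = ⊥-elim (Joins-≢ (Triangle.ab-Joins (tri i)) (sym eq))
    corner-injectiveʳ i {suc zero}         {suc zero}         _  = refl
    corner-injectiveʳ i {suc zero}         {suc (suc zero)}   eq = ⊥-elim (Joins-≢ (Triangle.bc-Joins (tri i)) eq)
    corner-injectiveʳ i {suc (suc zero)}   {zero}             eq = ⊥-elim (Joins-≢ (Triangle.ac-Joins (tri i)) (sym eq))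
    corner-injectiveʳ i {suc (suc zero)}   {suc zero}         eq = ⊥-elim (Joins-≢ (Triangle.bc-Joins (tri i)) (sym eq))
    corner-injectiveʳ i {suc (suc zero)}   {suc (suc zero)}   _  = refl

    corner-injective : ∀ {i p j q} → corner i p ≡ corner j q → (i , p) ≡ (j , q)
    corner-injective {i} {p} {j} {q} eq with same-triangle (corner-inside i p) (subst (Component S (f j)) (sym eq) (corner-inside j q))
    ... | refl = cong (i ,_) (corner-injectiveʳ i eq)

    vertex-triangle : ∀ v → ∃ λ i → Component S (f i) v
    vertex-triangle v with injective⇒onto (uncurry corner ∘ Fin.remQuot 3) corners-injective (trans (ℕ.*-comm t 3) 3t≡d) v
      where
      corners-injective : Injective _≡_ _≡_ (uncurry corner ∘ Fin.remQuot {t} 3)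
      corners-injective {x} {y} eq = begin
        x                                        ≡⟨ Fin.combine-remQuot {t} 3 x ⟨
        uncurry Fin.combine (Fin.remQuot {t} 3 x) ≡⟨ cong (uncurry Fin.combine) (corner-injective eq) ⟩
        uncurry Fin.combine (Fin.remQuot {t} 3 y) ≡⟨ Fin.combine-remQuot {t} 3 y ⟩
        y                                        ∎
        where open ≡-Reasoning
    ... | x , eq = proj₁ (Fin.remQuot {t} 3 x) , subst (Component S (f _)) eq (uncurry corner-inside (Fin.remQuot {t} 3 x))

    RowSq≡¾ : ∀ k → RowSq k ≡ ¾
    RowSq≡¾ k with vertex-triangle (src k)
    ... | i , fi~src = begin
      RowSq k                                         ≡⟨ sumList≡sumℚ distinct outside≡0 ⟨
      sumList (map (λ v → W k v ²) (a ∷ b ∷ c ∷ []))  ≡⟨ sumList-row²-const k (inside (inj₁ refl) ∷ inside (inj₂ (inj₁ refl)) ∷ inside (inj₂ (inj₂ refl)) ∷ []) ⟩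
      sumList (map (const ¼) (a ∷ b ∷ c ∷ []))        ≡⟨⟩
      ¾                                               ∎
      where
      open ≡-Reasoning
      open Triangle (tri i)
      k∈Δ : InEdges k
      k∈Δ = Equivalence.from (InEdges⇔Component-src k) fi~src
      inside : ∀ {v} → InTriple a b c v → W k v ² ≡ ¼
      inside v∈ = trans (triangle-sq i k v∈) (cong (_* ¼) (indicator-yes (InEdges? k) k∈Δ))
      distinct : Unique (a ∷ b ∷ c ∷ [])
      distinct = (Joins-≢ ab-Joins ∷ Joins-≢ ac-Joins ∷ []) ∷ (Joins-≢ bc-Joins ∷ []) ∷ [] ∷ []
      outside≡0 : ∀ v → All (v ≢_) (a ∷ b ∷ c ∷ []) → W k v ² ≡ 0ℚ
      outside≡0 v (v≢a ∷ v≢b ∷ v≢c ∷ []) with vertex-triangle v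
      ... | i′ , fi′~v = begin
        W k v ²
          ≡⟨ triangle-sq i′ k (Equivalence.to (Triangle.members (tri i′) v) fi′~v) ⟩
        indicator (Triangle.InEdges? (tri i′) k) * ¼
          ≡⟨ cong (_* ¼) (indicator-no (Triangle.InEdges? (tri i′) k) k∉Δ′) ⟩
        0ℚ * ¼
          ≡⟨⟩
        0ℚ ∎
        where
        k∉Δ′ : ¬ Triangle.InEdges (tri i′) k
        k∉Δ′ k∈Δ′ with same-triangle fi~src (Equivalence.to (Triangle.InEdges⇔Component-src (tri i′) k) k∈Δ′)
        ... | refl = [ v≢a , [ v≢b , v≢c ]′ ]′ (Equivalence.to (members v) fi′~v)

    trace≡3d/4 : ∀ {W′} → IsInverse (VS S ⊗ transpose (VS S)) W′ → trace W′ ≡ (+ (3 ℕ.* d)) / 4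
    trace≡3d/4 {W′} inv = begin
      trace W′
        ≡⟨ trace≡sumℚ-RowSq inv ⟩
      sumℚ RowSq
        ≡⟨ sumℚ-cong RowSq≡¾ ⟩
      sumℚ {d} (const ¾)
        ≡⟨ sumℚ-const d ¾ ⟩
      fromℕ d * ¾
        ≡⟨⟩
      fromℕ d * (fromℕ 3 * ¼)
        ≡⟨ solve 2 (λ x y → x :* (y :* con ¼) := (y :* x) :* con ¼) refl (fromℕ d) (fromℕ 3) ⟩
      (fromℕ 3 * fromℕ d) * ¼
        ≡⟨ cong (_* ¼) (fromℕ-* 3 d) ⟨
      fromℕ (3 ℕ.* d) * ¼
        ≡⟨ /-as-* (3 ℕ.* d) 3 ⟨
      (+ (3 ℕ.* d)) / 4 ∎
      where open ≡-Reasoning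

lemmaD1 : (d : ℕ) (E : Edge d → Set) (S : Fin d → Edge d)
    → (∀ k → E (S k))
    → (∀ k l → ends (S k) ≡ ends (S l) → k ≡ l)
    → Invertible (VS S)
    → (∀ r → TreePlusEdge S r)
      × (∀ (t : ℕ) → NumTriangleComps S t
          → ((3 ℕ.* t ≡ d → ∀ W → IsInverse (VS S ⊗ transpose (VS S)) W
                 → trace W ≡ (+ (3 ℕ.* d)) / 4)
             × (∀ W → IsInverse (VS S ⊗ transpose (VS S)) W
                 → (+ d) / 1 - (+ (3 ℕ.* t)) / 4 ≤ trace W)))
lemmaD1 d E S _ S-injective (W , VW≋I , WV≋I) =
  (λ r → Graph.TreePlusEdge-of-count S r (#CompEdges≡#Component S VW≋I WV≋I r)) ,
  λ t (f , f-injective , triangle-roots) →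
    let open Trace S S-injective VW≋I WV≋I f f-injective triangle-roots
    in (λ 3t≡d W′ → AllTriangles.trace≡3d/4 3t≡d) , (λ W′ → trace-lower)
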